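{- For all $k \ge 2$ and all $n \ge 1$, $$|S_n(132, 213, 23\ldots k\,1)| = \sum_{i=1}^n F_{k-2,i}.$$ Moreover, the generating function $f(x) = \sum_{n=0}^\infty |S_n(132, 213, 23\ldots k\,1)|\, x^n$ is given by $$f(x) = \frac{x}{(1-x)\left(1 - \sum_{j=1}^{k-2} x^j\right)} + 1.$$
   Context: Permutations of $[n]$ are written in one-line notation, and $S_n$ denotes the set of them. A permutation $\pi\in S_n$ contains $\sigma\in S_m$ if there are indices $i_1<\dots<i_m$ such that for all $a,b$, $\pi(i_a)<\pi(i_b)$ iff $\sigma(a)<\sigma(b)$; otherwise $\pi$ avoids $\sigma$. For a set $R$ of permutations, $S_n(R)$ is the set of $\pi\in S_n$ avoiding every element of $R$; $S_0(R)$ consists of the empty permutation only. The permutation $23\ldots k\,1\in S_k$ is $2,3,\dots,k$ followed by $1$ (for $k=2$ it is $21$). For $m\ge 0$ the $m$-generalized Fibonacci numbers are defined by $F_{m,n}=0$ for $n\le 0$, $F_{m,1}=1$, and $F_{m,n}=\sum_{i=1}^m F_{m,n-i}$ for $n\ge 2$ (so for $m=0$ the sum is empty). -}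

module Defs where

open import Data.Nat using (ℕ; zero; suc; _∸_)
import Data.Nat as N
open import Data.Fin using (Fin; _<_) renaming (zero to fzero; suc to fsuc)
open import Data.Vec using (Vec; []; _∷_; _∷ʳ_; lookup; allFin)
import Data.Vec as V
open import Data.List using (List; length; upTo; map; foldr)
open import Data.Nat.ListAction using (sum)
open import Data.Bool using (true; false)
open import Data.List.Membership.Propositional using (_∈_)
open import Data.List.Relation.Unary.Unique.Propositional using (Unique)
open import Data.Integer using (ℤ; +_; -[1+_])
import Data.Integer as Z
open import Data.Product using (Σ; _×_; ∃)
open import Function.Bundles using (_⇔_)
open import Function.Definitions using (Bijective)
open import Relation.Nullary using (¬_)
open import Relation.Binary.PropositionalEquality using (_≡_)

-- Permutations of [n], one-line notation, values shifted to 0..n-1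
-- (pattern containment only depends on the relative order).

Word : ℕ → Set
Word n = Vec (Fin n) n

IsPerm : ∀ {n} → Word n → Set
IsPerm π = Bijective _≡_ _≡_ (lookup π)

StrictlyIncreasing : ∀ {m n} → (Fin m → Fin n) → Set
StrictlyIncreasing ι = ∀ {a b} → a < b → ι a < ι b

Contains : ∀ {n m} → Word n → Word m → Set
Contains {n} {m} π σ =
  Σ (Fin m → Fin n) λ ι → StrictlyIncreasing ι ×
    (∀ a b → (lookup π (ι a) < lookup π (ι b)) ⇔ (lookup σ a < lookup σ b))

Avoids : ∀ {n m} → Word n → Word m → Set
Avoids π σ = ¬ Contains π σ

p132 : Word 3
p132 = fzero ∷ fsuc (fsuc fzero) ∷ fsuc fzero ∷ []

p213 : Word 3
p213 = fsuc fzero ∷ fzero ∷ fsuc (fsuc fzero) ∷ []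

p23k1 : (k : ℕ) → Word k
p23k1 zero    = []
p23k1 (suc k) = V.map fsuc (allFin k) ∷ʳ fzero

InAv : (k n : ℕ) → Word n → Set
InAv k n π = IsPerm π × Avoids π p132 × Avoids π p213 × Avoids π (p23k1 k)

HasSize : {A : Set} → (A → Set) → ℕ → Set
HasSize {A} P c = Σ (List A) λ L → Unique L × (∀ x → (x ∈ L) ⇔ P x) × length L ≡ c

-- m-generalized Fibonacci numbers F m n  (= F_{m,n}; F_{m,n} = 0 for n ≤ 0)

mutual
  F : ℕ → ℕ → ℕ
  F m zero          = 0
  F m (suc zero)    = 1
  F m (suc (suc n)) = G m m (suc n)

  G : ℕ → ℕ → ℕ → ℕ
  G m zero    j       = 0
  G m (suc i) zero    = 0
  G m (suc i) (suc j) = F m (suc j) N.+ G m i j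

sumF : ℕ → ℕ → ℕ
sumF m n = sum (map (λ i → F m (suc i)) (upTo n))

Series : Set
Series = ℕ → ℤ

sumℤ : List ℤ → ℤ
sumℤ = foldr Z._+_ (+ 0)

_≈ₛ_ : Series → Series → Set
f ≈ₛ g = ∀ n → f n ≡ g n

_⊕_ : Series → Series → Series
(f ⊕ g) n = f n Z.+ g n

_⊖_ : Series → Series → Series
(f ⊖ g) n = f n Z.- g n

_⊛_ : Series → Series → Series
(f ⊛ g) n = sumℤ (map (λ i → f i Z.* g (n ∸ i)) (upTo (suc n)))

oneₛ : Series
oneₛ zero    = + 1
oneₛ (suc _) = + 0

xₛ : Series
xₛ (suc zero) = + 1
xₛ _          = + 0

xsum : ℕ → Series
xsum m zero    = + 0
xsum m (suc j) with suc j N.≤ᵇ m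
... | true  = + 1
... | false = + 0

-- A permutation avoids 132 and 213 exactly when it is a decreasing sequence of
-- increasing runs of consecutive values, so it is determined by its descent set:
-- two entries are in increasing order iff no descent lies between them. It then
-- avoids 23…k1 iff only its last run has length at least k − 1. Reading the
-- descent word of length n − 1, such permutations are counted by the words in
-- which every ascending stretch of length k − 2 is followed only by ascents;
-- by the first descent, these satisfy the recurrence of the partial sums
-- Σ_{i ≤ n} F_{k−2,i}. The same recurrence says that the series of these partial
-- sums times (1 − x)(1 − x − … − x^{k−2}) is 1.

module Submission where

open import Defs

module Enumeration where
  open import Data.Nat using (ℕ; zero; suc; _+_; _∸_; _≤_; _<_; z≤n; s≤s; _<ᵇ_; _<?_)
  open import Data.Nat.Properties
  open import Data.Bool using (Bool; true; false; T)
  open import Data.Bool.Properties using (T-≡)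
  open import Data.Bool.ListAction using (or)
  open import Data.Fin using (Fin; toℕ; fromℕ; fromℕ<; inject₁; punchIn; punchOut) renaming (zero to fzero; suc to fsuc)
  import Data.Fin as Fin
  import Data.Fin.Properties as Fin
  open import Data.Vec using (Vec; []; _∷_; lookup; _∷ʳ_; allFin)
  import Data.Vec as Vec
  import Data.Vec.Properties as Vec
  open import Data.List using (List; []; _∷_; _++_; map; length; replicate; upTo)
  import Data.List as List
  open import Data.List.Properties using (length-++; length-map; length-replicate; map-++; applyUpTo-∷ʳ; length-removeAt′)
  open import Data.Nat.ListAction using (sum)
  open import Data.Nat.ListAction.Properties using (sum-++)
  open import Data.List.Membership.Propositional using (_∈_)
  open import Data.List.Membership.Propositional.Properties using (∈-map⁺; ∈-map⁻; ∈-++⁺ˡ; ∈-++⁺ʳ; ∈-++⁻)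
  open import Data.List.Relation.Unary.Any using (here; there; _─_; index)
  import Data.List.Relation.Unary.All as All
  import Data.List.Relation.Unary.All.Properties as All
  open import Data.List.Relation.Unary.AllPairs using ([]; _∷_)
  open import Data.List.Relation.Unary.Unique.Propositional using (Unique)
  import Data.List.Relation.Unary.Unique.Propositional.Properties as Unique
  open import Data.Product using (_×_; _,_; proj₁; proj₂; ∃)
  open import Data.Sum using (_⊎_; inj₁; inj₂)
  open import Data.Empty using (⊥; ⊥-elim)
  open import Relation.Nullary using (¬_; yes; no; contradiction)
  open import Relation.Binary.PropositionalEquality
  open import Relation.Binary.Definitions using (tri<; tri≈; tri>)
  open import Data.Nat.Tactic.RingSolver using (solve-∀)
  open import Function using (_∘_)
  open import Function.Definitions using (Injective; Surjective)
  open import Function.Bundles using (_⇔_; mk⇔; Equivalence)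

  -- A descent word records, for each position l, whether π(l) > π(l+1);
  -- positions beyond its end read as false.

  bitAt : List Bool → ℕ → Bool
  bitAt []      _       = false
  bitAt (b ∷ w) zero    = b
  bitAt (b ∷ w) (suc l) = bitAt w l

  bitAt-beyond : ∀ w l → length w ≤ l → bitAt w l ≡ false
  bitAt-beyond []      l       _         = refl
  bitAt-beyond (x ∷ w) (suc l) (s≤s len) = bitAt-beyond w l len

  bitAt-injective : ∀ w w′ → length w ≡ length w′ → (∀ l → bitAt w l ≡ bitAt w′ l) → w ≡ w′
  bitAt-injective []      []       _   _  = refl
  bitAt-injective (x ∷ w) (y ∷ w′) len eq =
    cong₂ _∷_ (eq 0) (bitAt-injective w w′ (suc-injective len) (λ l → eq (suc l)))

  NoDescentIn : (ℕ → Bool) → ℕ → ℕ → Set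
  NoDescentIn d a c = ∀ l → a ≤ l → l < c → d l ≡ false

  NoDescentIn-mono : ∀ {d a c a′ c′} → NoDescentIn d a c → a ≤ a′ → c′ ≤ c → NoDescentIn d a′ c′
  NoDescentIn-mono nd a≤a′ c′≤c l a′≤l l<c′ = nd l (≤-trans a≤a′ a′≤l) (<-≤-trans l<c′ c′≤c)

  NoDescentIn-shift⁻ : ∀ {d i j} → NoDescentIn d (suc i) (suc j) → NoDescentIn (d ∘ suc) i j
  NoDescentIn-shift⁻ nd l i≤l l<j = nd (suc l) (s≤s i≤l) (s≤s l<j)

  NoDescentIn-shift⁺ : ∀ {d i j} → NoDescentIn (d ∘ suc) i j → NoDescentIn d (suc i) (suc j)
  NoDescentIn-shift⁺ nd (suc l) (s≤s i≤l) (s≤s l<j) = nd l i≤l l<j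

  NoDescentIn-cons⁺ : ∀ {d j} → d 0 ≡ false → NoDescentIn (d ∘ suc) 0 j → NoDescentIn d 0 (suc j)
  NoDescentIn-cons⁺ d0 nd zero    _ _         = d0
  NoDescentIn-cons⁺ d0 nd (suc l) _ (s≤s l<j) = nd l z≤n l<j

  NoDescentIn-cons⁻ : ∀ {d j} → NoDescentIn d 0 (suc j) → NoDescentIn (d ∘ suc) 0 j
  NoDescentIn-cons⁻ nd l _ l<j = nd (suc l) z≤n (s≤s l<j)

  -- m ascents in a row are m + 1 increasing entries, and a later descent would
  -- complete a copy of 23…k1 with k = m + 2.
  Admissible : ℕ → (ℕ → Bool) → Set
  Admissible m d = ∀ a l → NoDescentIn d a (a + m) → a + m ≤ l → d l ≡ false

  InitiallyAdmissible : ℕ → (ℕ → Bool) → Set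
  InitiallyAdmissible b d = NoDescentIn d 0 b → ∀ l → b ≤ l → d l ≡ false

  sumF-suc : ∀ m n → sumF m (suc n) ≡ sumF m n + F m (suc n)
  sumF-suc m n = begin
    sum (map f (upTo (suc n)))           ≡⟨ cong (sum ∘ map f) (sym (applyUpTo-∷ʳ (λ i → i) n)) ⟩
    sum (map f (upTo n List.∷ʳ n))       ≡⟨ cong sum (map-++ f (upTo n) (n ∷ [])) ⟩
    sum (map f (upTo n) ++ (f n ∷ []))   ≡⟨ sum-++ (map f (upTo n)) (f n ∷ []) ⟩
    sumF m n + (f n + 0)                 ≡⟨ cong (sumF m n +_) (+-identityʳ (f n)) ⟩
    sumF m n + f n                       ∎
    where
    open ≡-Reasoning
    f : ℕ → ℕ
    f i = F m (suc i)

  sumF-window : ∀ m i N → sumF m N ≡ sumF m (N ∸ i) + G m i N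
  sumF-window m zero    N       = sym (+-identityʳ (sumF m N))
  sumF-window m (suc i) zero    = refl
  sumF-window m (suc i) (suc N) = begin
    sumF m (suc N)                                 ≡⟨ sumF-suc m N ⟩
    sumF m N + F m (suc N)                         ≡⟨ cong (_+ F m (suc N)) (sumF-window m i N) ⟩
    (sumF m (N ∸ i) + G m i N) + F m (suc N)       ≡⟨ +-assoc (sumF m (N ∸ i)) (G m i N) (F m (suc N)) ⟩
    sumF m (N ∸ i) + (G m i N + F m (suc N))       ≡⟨ cong (sumF m (N ∸ i) +_) (+-comm (G m i N) (F m (suc N))) ⟩
    sumF m (N ∸ i) + (F m (suc N) + G m i N)       ∎
    where open ≡-Reasoning

  sumF-recurrence : ∀ m n → sumF m (suc (suc n)) + sumF m (suc n ∸ m) ≡ sumF m (suc n) + sumF m (suc n)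
  sumF-recurrence m n = begin
    sumF m (suc (suc n)) + sumF m (suc n ∸ m)
      ≡⟨ cong (_+ sumF m (suc n ∸ m)) (sumF-suc m (suc n)) ⟩
    (sumF m (suc n) + G m m (suc n)) + sumF m (suc n ∸ m)
      ≡⟨ +-assoc (sumF m (suc n)) (G m m (suc n)) (sumF m (suc n ∸ m)) ⟩
    sumF m (suc n) + (G m m (suc n) + sumF m (suc n ∸ m))
      ≡⟨ cong (sumF m (suc n) +_) (trans (+-comm (G m m (suc n)) _) (sym (sumF-window m m (suc n)))) ⟩
    sumF m (suc n) + sumF m (suc n) ∎
    where open ≡-Reasoning

  sumF-zero-suc : ∀ n → sumF 0 (suc n) ≡ 1
  sumF-zero-suc zero    = refl
  sumF-zero-suc (suc n) = trans (sumF-suc 0 (suc n)) (trans (+-identityʳ _) (sumF-zero-suc n))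

  module AdmissibleWords (m : ℕ) where

    -- b counts the ascents still allowed before a descent is due; once they are
    -- used up, no descent may follow.
    admissibleFrom : ℕ → List Bool → Bool
    admissibleFrom b       []          = true
    admissibleFrom zero    (false ∷ w) = admissibleFrom zero w
    admissibleFrom zero    (true ∷ w)  = false
    admissibleFrom (suc b) (false ∷ w) = admissibleFrom b w
    admissibleFrom (suc b) (true ∷ w)  = admissibleFrom m w

    mutual
      admissibleWords : ℕ → List (List Bool)
      admissibleWords L = replicate L false ∷ withDescent m L

      -- the words w of length L that contain a descent and satisfy admissibleFrom b w
      withDescent : ℕ → ℕ → List (List Bool)
      withDescent zero    L       = []
      withDescent (suc b) zero    = []
      withDescent (suc b) (suc L) =
        map (true ∷_) (admissibleWords L) ++ map (false ∷_) (withDescent b L)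

    admissibleFrom-replicate : ∀ b L → admissibleFrom b (replicate L false) ≡ true
    admissibleFrom-replicate b       zero    = refl
    admissibleFrom-replicate zero    (suc L) = admissibleFrom-replicate zero L
    admissibleFrom-replicate (suc b) (suc L) = admissibleFrom-replicate b L

    admissibleFrom-zero : ∀ w → admissibleFrom 0 w ≡ true → or w ≡ false
    admissibleFrom-zero []          _  = refl
    admissibleFrom-zero (false ∷ w) ok = admissibleFrom-zero w ok

    or-replicate : ∀ L → or (replicate L false) ≡ false
    or-replicate zero    = refl
    or-replicate (suc L) = or-replicate L

    or≡false⇒replicate : ∀ w → or w ≡ false → w ≡ replicate (length w) false
    or≡false⇒replicate []          _  = refl
    or≡false⇒replicate (false ∷ w) none = cong (false ∷_) (or≡false⇒replicate w none)

    mutual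
      ∈-admissibleWords⁻ : ∀ L w → w ∈ admissibleWords L →
                           length w ≡ L × admissibleFrom m w ≡ true
      ∈-admissibleWords⁻ L w (here refl) = length-replicate L , admissibleFrom-replicate m L
      ∈-admissibleWords⁻ L w (there w∈) =
        let len , ok , _ = ∈-withDescent⁻ m L w w∈ in len , ok

      ∈-withDescent⁻ : ∀ b L w → w ∈ withDescent b L →
                       length w ≡ L × admissibleFrom b w ≡ true × or w ≡ true
      ∈-withDescent⁻ (suc b) (suc L) w w∈ with ∈-++⁻ (map (true ∷_) (admissibleWords L)) w∈
      ... | inj₁ w∈₁ with ∈-map⁻ (true ∷_) w∈₁
      ...   | w′ , w′∈ , refl = let len , ok = ∈-admissibleWords⁻ L w′ w′∈ in cong suc len , ok , refl
      ∈-withDescent⁻ (suc b) (suc L) w w∈ | inj₂ w∈₂ with ∈-map⁻ (false ∷_) w∈₂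
      ...   | w′ , w′∈ , refl = let len , ok , desc = ∈-withDescent⁻ b L w′ w′∈ in cong suc len , ok , desc

    mutual
      ∈-admissibleWords⁺ : ∀ w → admissibleFrom m w ≡ true → w ∈ admissibleWords (length w)
      ∈-admissibleWords⁺ w ok with or w in desc
      ... | false = here (or≡false⇒replicate w desc)
      ... | true  = there (∈-withDescent⁺ m w ok desc)

      ∈-withDescent⁺ : ∀ b w → admissibleFrom b w ≡ true → or w ≡ true → w ∈ withDescent b (length w)
      ∈-withDescent⁺ (suc b) (true ∷ w) ok desc = ∈-++⁺ˡ (∈-map⁺ (true ∷_) (∈-admissibleWords⁺ w ok))
      ∈-withDescent⁺ zero (false ∷ w) ok desc with () ← trans (sym (admissibleFrom-zero w ok)) desc
      ∈-withDescent⁺ (suc b) (false ∷ w) ok desc =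
        ∈-++⁺ʳ (map (true ∷_) (admissibleWords (length w))) (∈-map⁺ (false ∷_) (∈-withDescent⁺ b w ok desc))

    mutual
      admissibleWords-unique : ∀ L → Unique (admissibleWords L)
      admissibleWords-unique L = All.tabulate distinct ∷ withDescent-unique m L
        where
        distinct : ∀ {w} → w ∈ withDescent m L → replicate L false ≢ w
        distinct w∈ refl with () ← trans (sym (or-replicate L)) (proj₂ (proj₂ (∈-withDescent⁻ m L _ w∈)))

      withDescent-unique : ∀ b L → Unique (withDescent b L)
      withDescent-unique zero    L       = []
      withDescent-unique (suc b) zero    = []
      withDescent-unique (suc b) (suc L) =
        Unique.++⁺ (Unique.map⁺ ∷-injectiveʳ (admissibleWords-unique L))
                   (Unique.map⁺ ∷-injectiveʳ (withDescent-unique b L)) disjoint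
        where
        ∷-injectiveʳ : ∀ {x : Bool} {u v : List Bool} → x ∷ u ≡ x ∷ v → u ≡ v
        ∷-injectiveʳ refl = refl
        disjoint : ∀ {v} → ¬ (v ∈ map (true ∷_) (admissibleWords L) × v ∈ map (false ∷_) (withDescent b L))
        disjoint (v∈₁ , v∈₂) with ∈-map⁻ (true ∷_) v∈₁ | ∈-map⁻ (false ∷_) v∈₂
        ... | _ , _ , refl | _ , _ , ()

    sumG : ℕ → ℕ → ℕ
    sumG i zero    = 0
    sumG i (suc L) = sumG i L + G m i (suc L)

    sumG-zero : ∀ L → sumG 0 L ≡ 0
    sumG-zero zero    = refl
    sumG-zero (suc L) = cong (_+ 0) (sumG-zero L)

    G-zero : ∀ i → G m i 0 ≡ 0
    G-zero zero    = refl
    G-zero (suc i) = refl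

    sumG-suc : ∀ i L → sumG (suc i) (suc L) ≡ sumF m (suc L) + sumG i L
    sumG-suc i zero rewrite G-zero i = refl
    sumG-suc i (suc L) = begin
      sumG (suc i) (suc L) + G m (suc i) (suc (suc L))
        ≡⟨ cong (_+ (F m (suc (suc L)) + G m i (suc L))) (sumG-suc i L) ⟩
      (sumF m (suc L) + sumG i L) + (F m (suc (suc L)) + G m i (suc L))
        ≡⟨ interchange (sumF m (suc L)) (sumG i L) (F m (suc (suc L))) (G m i (suc L)) ⟩
      (sumF m (suc L) + F m (suc (suc L))) + sumG i (suc L)
        ≡⟨ cong (_+ sumG i (suc L)) (sym (sumF-suc m (suc L))) ⟩
      sumF m (suc (suc L)) + sumG i (suc L) ∎
      where
      open ≡-Reasoning
      interchange : ∀ a b c d → (a + b) + (c + d) ≡ (a + c) + (b + d)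
      interchange = solve-∀

    -- F m (L + 2) = G m m (L + 1) is the Fibonacci recurrence
    suc-sumG : ∀ L → suc (sumG m L) ≡ sumF m (suc L)
    suc-sumG zero    = refl
    suc-sumG (suc L) = trans (cong (_+ G m m (suc L)) (suc-sumG L)) (sym (sumF-suc m (suc L)))

    length-withDescent : ∀ i L → length (withDescent i L) ≡ sumG i L
    length-withDescent zero    L       = sym (sumG-zero L)
    length-withDescent (suc i) zero    = refl
    length-withDescent (suc i) (suc L) = begin
      length (map (true ∷_) (admissibleWords L) ++ map (false ∷_) (withDescent i L))
        ≡⟨ length-++ (map (true ∷_) (admissibleWords L)) ⟩
      length (map (true ∷_) (admissibleWords L)) + length (map (false ∷_) (withDescent i L))
        ≡⟨ cong₂ _+_ (length-map (true ∷_) (admissibleWords L)) (length-map (false ∷_) (withDescent i L)) ⟩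
      suc (length (withDescent m L)) + length (withDescent i L)
        ≡⟨ cong₂ _+_ (cong suc (length-withDescent m L)) (length-withDescent i L) ⟩
      suc (sumG m L) + sumG i L
        ≡⟨ cong (_+ sumG i L) (suc-sumG L) ⟩
      sumF m (suc L) + sumG i L
        ≡⟨ sym (sumG-suc i L) ⟩
      sumG (suc i) (suc L) ∎
      where open ≡-Reasoning

    length-admissibleWords : ∀ L → length (admissibleWords L) ≡ sumF m (suc L)
    length-admissibleWords L = trans (cong suc (length-withDescent m L)) (suc-sumG L)

    or≡false⇒bitAt : ∀ w → or w ≡ false → ∀ l → bitAt w l ≡ false
    or≡false⇒bitAt []          _    l       = refl
    or≡false⇒bitAt (false ∷ w) none zero    = refl
    or≡false⇒bitAt (false ∷ w) none (suc l) = or≡false⇒bitAt w none l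

    bitAt≡false⇒admissibleFrom : ∀ w → (∀ l → bitAt w l ≡ false) → admissibleFrom 0 w ≡ true
    bitAt≡false⇒admissibleFrom []          _    = refl
    bitAt≡false⇒admissibleFrom (false ∷ w) none = bitAt≡false⇒admissibleFrom w (none ∘ suc)
    bitAt≡false⇒admissibleFrom (true ∷ w)  none with () ← none 0

    Admissible-tail : ∀ x w → Admissible m (bitAt (x ∷ w)) → Admissible m (bitAt w)
    Admissible-tail x w adm a l nd a+m≤l = adm (suc a) (suc l) (NoDescentIn-shift⁺ nd) (s≤s a+m≤l)

    Admissible-cons : ∀ x w → Admissible m (bitAt w) → InitiallyAdmissible m (bitAt (x ∷ w)) →
                      Admissible m (bitAt (x ∷ w))
    Admissible-cons x w adm init zero    l       nd m≤l         = init nd l m≤l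
    Admissible-cons x w adm init (suc a) (suc l) nd (s≤s a+m≤l) = adm a l (NoDescentIn-shift⁻ nd) a+m≤l

    admissibleFrom⇒Admissible : ∀ b w → b ≤ m → admissibleFrom b w ≡ true →
                                InitiallyAdmissible b (bitAt w) × Admissible m (bitAt w)
    admissibleFrom⇒Admissible zero w _ ok =
      (λ _ l _ → ascending l) , (λ _ l _ _ → ascending l)
      where ascending = or≡false⇒bitAt w (admissibleFrom-zero w ok)
    admissibleFrom⇒Admissible (suc b) [] _ _ = (λ _ _ _ → refl) , (λ _ _ _ _ → refl)
    admissibleFrom⇒Admissible (suc b) (false ∷ w) b<m ok =
      init , Admissible-cons false w adm initₘ
      where
      b≤m = ≤-trans (n≤1+n b) b<m
      IH = admissibleFrom⇒Admissible b w b≤m ok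
      adm = proj₂ IH
      init : InitiallyAdmissible (suc b) (bitAt (false ∷ w))
      init nd (suc l) (s≤s b≤l) = proj₁ IH (NoDescentIn-shift⁻ (NoDescentIn-mono nd z≤n ≤-refl)) l b≤l
      initₘ : InitiallyAdmissible m (bitAt (false ∷ w))
      initₘ nd zero    _   = refl
      initₘ nd (suc l) m≤l =
        proj₁ IH (NoDescentIn-shift⁻ (NoDescentIn-mono nd z≤n b<m)) l (≤-pred (≤-trans b<m m≤l))
    admissibleFrom⇒Admissible (suc b) (true ∷ w) b<m ok =
      (λ nd → contradiction (nd 0 z≤n (s≤s z≤n)) λ ()) ,
      Admissible-cons true w (proj₂ (admissibleFrom⇒Admissible m w ≤-refl ok))
                      (λ nd → contradiction (nd 0 z≤n (≤-trans (s≤s z≤n) b<m)) λ ())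

    Admissible⇒admissibleFrom : ∀ b w → b ≤ m → InitiallyAdmissible b (bitAt w) → Admissible m (bitAt w) →
                                admissibleFrom b w ≡ true
    Admissible⇒admissibleFrom b [] _ _ _ = refl
    Admissible⇒admissibleFrom zero w _ init _ = bitAt≡false⇒admissibleFrom w (λ l → init (λ _ _ ()) l z≤n)
    Admissible⇒admissibleFrom (suc b) (false ∷ w) b<m init adm =
      Admissible⇒admissibleFrom b w (≤-trans (n≤1+n b) b<m) init′ (Admissible-tail false w adm)
      where
      init′ : InitiallyAdmissible b (bitAt w)
      init′ nd l b≤l = init nd′ (suc l) (s≤s b≤l)
        where
        nd′ : NoDescentIn (bitAt (false ∷ w)) 0 (suc b)
        nd′ zero    _ _         = refl
        nd′ (suc j) _ (s≤s j<b) = nd j z≤n j<b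
    Admissible⇒admissibleFrom (suc b) (true ∷ w) b<m init adm =
      Admissible⇒admissibleFrom m w ≤-refl init′ (Admissible-tail true w adm)
      where
      init′ : InitiallyAdmissible m (bitAt w)
      init′ nd l m≤l = adm 1 (suc l) (NoDescentIn-shift⁺ nd) (s≤s m≤l)

    admissibleFrom⇔Admissible : ∀ w → admissibleFrom m w ≡ true ⇔ Admissible m (bitAt w)
    admissibleFrom⇔Admissible w =
      mk⇔ (proj₂ ∘ admissibleFrom⇒Admissible m w ≤-refl)
          (λ adm → Admissible⇒admissibleFrom m w ≤-refl (λ nd l m≤l → adm 0 l nd m≤l) adm)

  -- Entries of a vector over Fin as naturals; an index out of range gives the junk value 0.
  entry : ∀ {n L} → Vec (Fin n) L → ℕ → ℕ
  entry []       _       = 0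
  entry (x ∷ xs) zero    = toℕ x
  entry (x ∷ xs) (suc i) = entry xs i

  entry-toℕ : ∀ {n L} (xs : Vec (Fin n) L) i → entry xs (toℕ i) ≡ toℕ (lookup xs i)
  entry-toℕ (x ∷ xs) fzero    = refl
  entry-toℕ (x ∷ xs) (fsuc i) = entry-toℕ xs i

  entry-fromℕ< : ∀ {n L} (xs : Vec (Fin n) L) {i} (i<L : i < L) → entry xs i ≡ toℕ (lookup xs (fromℕ< i<L))
  entry-fromℕ< xs i<L = trans (cong (entry xs) (sym (Fin.toℕ-fromℕ< i<L))) (entry-toℕ xs (fromℕ< i<L))

  entry< : ∀ {n L} (xs : Vec (Fin n) L) i → i < L → entry xs i < n
  entry< (x ∷ xs) zero    _         = Fin.toℕ<n x
  entry< (x ∷ xs) (suc i) (s≤s i<L) = entry< xs i i<L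

  entry-ext : ∀ {n L} (xs ys : Vec (Fin n) L) → (∀ i → i < L → entry xs i ≡ entry ys i) → xs ≡ ys
  entry-ext []       []       _  = refl
  entry-ext (x ∷ xs) (y ∷ ys) eq =
    cong₂ _∷_ (Fin.toℕ-injective (eq 0 (s≤s z≤n))) (entry-ext xs ys (λ i i<L → eq (suc i) (s≤s i<L)))

  InjectiveBelow : (ℕ → ℕ) → ℕ → Set
  InjectiveBelow f n = ∀ i j → i < n → j < n → f i ≡ f j → i ≡ j

  entry-injective : ∀ {n L} (xs : Vec (Fin n) L) → Injective _≡_ _≡_ (lookup xs) → InjectiveBelow (entry xs) L
  entry-injective xs inj i j i<L j<L eq =
    trans (sym (Fin.toℕ-fromℕ< i<L))
          (trans (cong toℕ (inj (Fin.toℕ-injective (trans (sym (entry-fromℕ< xs i<L)) (trans eq (entry-fromℕ< xs j<L))))))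
                 (Fin.toℕ-fromℕ< j<L))

  entry-surjective : ∀ {n L} (xs : Vec (Fin n) L) → Surjective _≡_ _≡_ (lookup xs) →
                     ∀ y → y < n → ∃ λ i → i < L × entry xs i ≡ y
  entry-surjective xs surj y y<n with surj (fromℕ< y<n)
  ... | i , hit = toℕ i , Fin.toℕ<n i , trans (entry-toℕ xs i) (trans (cong toℕ (hit refl)) (Fin.toℕ-fromℕ< y<n))

  -- the order structure of the 132- and 213-avoiding permutations with descent set d
  DescentOrdered : (ℕ → ℕ) → ℕ → (ℕ → Bool) → Set
  DescentOrdered f n d = ∀ i j → i < j → j < n → (f i < f j → NoDescentIn d i j) × (NoDescentIn d i j → f i < f j)

  punchInℕ : ℕ → ℕ → ℕ
  punchInℕ zero    y       = suc y
  punchInℕ (suc h) zero    = zero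
  punchInℕ (suc h) (suc y) = suc (punchInℕ h y)

  toℕ-punchIn : ∀ {n} (p : Fin (suc n)) (x : Fin n) → toℕ (punchIn p x) ≡ punchInℕ (toℕ p) (toℕ x)
  toℕ-punchIn fzero    x        = refl
  toℕ-punchIn (fsuc p) fzero    = refl
  toℕ-punchIn (fsuc p) (fsuc x) = cong suc (toℕ-punchIn p x)

  punchInℕ-< : ∀ {h y} → y < h → punchInℕ h y ≡ y
  punchInℕ-< {suc h} {zero}  _         = refl
  punchInℕ-< {suc h} {suc y} (s≤s y<h) = cong suc (punchInℕ-< y<h)

  ≤⇒<punchInℕ : ∀ {h y} → h ≤ y → h < punchInℕ h y
  ≤⇒<punchInℕ {zero}  _         = s≤s z≤n
  ≤⇒<punchInℕ {suc h} (s≤s h≤y) = s≤s (≤⇒<punchInℕ h≤y)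

  <punchInℕ⇒≤ : ∀ {h y} → h < punchInℕ h y → h ≤ y
  <punchInℕ⇒≤ {zero}            _        = z≤n
  <punchInℕ⇒≤ {suc h} {suc y} (s≤s lt) = s≤s (<punchInℕ⇒≤ lt)

  punchInℕ-mono : ∀ h {y y′} → y < y′ → punchInℕ h y < punchInℕ h y′
  punchInℕ-mono zero    y<y′                 = s≤s y<y′
  punchInℕ-mono (suc h) {zero}  {suc y′} _   = s≤s z≤n
  punchInℕ-mono (suc h) {suc y} {suc y′} (s≤s y<y′) = s≤s (punchInℕ-mono h y<y′)

  punchInℕ-cancel : ∀ h {y y′} → punchInℕ h y < punchInℕ h y′ → y < y′
  punchInℕ-cancel zero    (s≤s y<y′)                 = y<y′
  punchInℕ-cancel (suc h) {zero}  {suc y′} _         = s≤s z≤n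
  punchInℕ-cancel (suc h) {suc y} {suc y′} (s≤s lt)  = s≤s (punchInℕ-cancel h lt)

  entry-map-punchIn : ∀ {n L} (p : Fin (suc n)) (xs : Vec (Fin n) L) j → j < L →
                      entry (Vec.map (punchIn p) xs) j ≡ punchInℕ (toℕ p) (entry xs j)
  entry-map-punchIn p (x ∷ xs) zero    _         = toℕ-punchIn p x
  entry-map-punchIn p (x ∷ xs) (suc j) (s≤s j<L) = entry-map-punchIn p xs j j<L

  -- Prepending an entry: after a descent it is the new maximum; after an ascent
  -- it takes the old first value, which moves up by one together with all larger ones.
  newHead : ∀ {n} → Bool → Vec (Fin (suc n)) (suc n) → Fin (suc (suc n))
  newHead true  _       = fromℕ _
  newHead false (x ∷ _) = inject₁ x

  consDescent : ∀ {n} → Bool → Vec (Fin (suc n)) (suc n) → Vec (Fin (suc (suc n))) (suc (suc n))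
  consDescent b τ = newHead b τ ∷ Vec.map (punchIn (newHead b τ)) τ

  -- the permutation with descent set d that is a decreasing sequence of
  -- increasing runs of consecutive values
  fromDescents : (n : ℕ) → (ℕ → Bool) → Word n
  fromDescents zero          d = []
  fromDescents (suc zero)    d = fzero ∷ []
  fromDescents (suc (suc n)) d = consDescent (d 0) (fromDescents (suc n) (d ∘ suc))

  cons-punchIn-injective : ∀ {n} (p : Fin (suc (suc n))) (τ : Vec (Fin (suc n)) (suc n)) →
                           Injective _≡_ _≡_ (lookup τ) → Injective _≡_ _≡_ (lookup (p ∷ Vec.map (punchIn p) τ))
  cons-punchIn-injective p τ inj {fzero}  {fzero}  eq = refl
  cons-punchIn-injective p τ inj {fzero}  {fsuc y} eq =
    ⊥-elim (Fin.punchInᵢ≢i p (lookup τ y) (sym (trans eq (Vec.lookup-map y (punchIn p) τ))))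
  cons-punchIn-injective p τ inj {fsuc x} {fzero}  eq =
    ⊥-elim (Fin.punchInᵢ≢i p (lookup τ x) (trans (sym (Vec.lookup-map x (punchIn p) τ)) eq))
  cons-punchIn-injective p τ inj {fsuc x} {fsuc y} eq = cong fsuc (inj (Fin.punchIn-injective p _ _
    (trans (sym (Vec.lookup-map x (punchIn p) τ)) (trans eq (Vec.lookup-map y (punchIn p) τ)))))

  cons-punchIn-surjective : ∀ {n} (p : Fin (suc (suc n))) (τ : Vec (Fin (suc n)) (suc n)) →
                            Surjective _≡_ _≡_ (lookup τ) → Surjective _≡_ _≡_ (lookup (p ∷ Vec.map (punchIn p) τ))
  cons-punchIn-surjective p τ surj y with p Fin.≟ y
  ... | yes refl = fzero , λ { refl → refl }
  ... | no p≢y with surj (punchOut p≢y)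
  ...   | x , hit = fsuc x , λ { refl →
            trans (Vec.lookup-map x (punchIn p) τ) (trans (cong (punchIn p) (hit refl)) (Fin.punchIn-punchOut p≢y)) }

  fromDescents-isPerm : ∀ n d → IsPerm (fromDescents n d)
  fromDescents-isPerm zero          d = (λ { {()} }) , (λ ())
  fromDescents-isPerm (suc zero)    d = (λ { {fzero} {fzero} _ → refl }) , (λ { fzero → fzero , λ { refl → refl } })
  fromDescents-isPerm (suc (suc n)) d =
    let inj , surj = fromDescents-isPerm (suc n) (d ∘ suc)
    in cons-punchIn-injective _ _ inj , cons-punchIn-surjective _ _ surj

  DescentOrdered-first : ∀ {f n d} → InjectiveBelow f n → DescentOrdered f n d →
                         ∀ j → j < n → (f 0 ≤ f j → NoDescentIn d 0 j) × (NoDescentIn d 0 j → f 0 ≤ f j)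
  DescentOrdered-first inj od zero    _   = (λ _ _ _ ()) , (λ _ → ≤-refl)
  DescentOrdered-first inj od (suc j) j<n =
    (λ f0≤fj → proj₁ (od 0 (suc j) (s≤s z≤n) j<n)
                     (≤∧≢⇒< f0≤fj (λ eq → 0≢1+n (inj 0 (suc j) (≤-trans (s≤s z≤n) j<n) j<n eq))))
    , (λ nd → <⇒≤ (proj₂ (od 0 (suc j) (s≤s z≤n) j<n) nd))

  toℕ-newHead-true : ∀ {n} (τ : Vec (Fin (suc n)) (suc n)) → toℕ (newHead true τ) ≡ suc n
  toℕ-newHead-true {n} _ = Fin.toℕ-fromℕ (suc n)

  toℕ-newHead-false : ∀ {n} (τ : Vec (Fin (suc n)) (suc n)) → toℕ (newHead false τ) ≡ entry τ 0
  toℕ-newHead-false (x ∷ _) = Fin.toℕ-inject₁ x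

  consDescent-descentOrdered : ∀ {n} d (τ : Vec (Fin (suc n)) (suc n)) →
    InjectiveBelow (entry τ) (suc n) → DescentOrdered (entry τ) (suc n) (d ∘ suc) →
    DescentOrdered (entry (consDescent (d 0) τ)) (suc (suc n)) d
  consDescent-descentOrdered d τ inj od (suc i) (suc j) (s≤s i<j) (s≤s j<n)
    rewrite entry-map-punchIn (newHead (d 0) τ) τ i (<-trans i<j j<n)
          | entry-map-punchIn (newHead (d 0) τ) τ j j<n
    = (λ lt → NoDescentIn-shift⁺ (proj₁ (od i j i<j j<n) (punchInℕ-cancel h lt)))
    , (λ nd → punchInℕ-mono h (proj₂ (od i j i<j j<n) (NoDescentIn-shift⁻ nd)))
    where h = toℕ (newHead (d 0) τ)
  consDescent-descentOrdered d τ inj od zero (suc j) _ (s≤s j<n)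
    rewrite entry-map-punchIn (newHead (d 0) τ) τ j j<n
    with d 0 in d0
  ... | true rewrite toℕ-newHead-true τ | punchInℕ-< (entry< τ j j<n) =
    (λ lt → ⊥-elim (<-asym lt (entry< τ j j<n))) ,
    (λ nd → contradiction (trans (sym d0) (nd 0 z≤n (s≤s z≤n))) λ ())
  ... | false rewrite toℕ-newHead-false τ =
    (λ lt → NoDescentIn-cons⁺ d0 (proj₁ (DescentOrdered-first inj od j j<n) (<punchInℕ⇒≤ lt))) ,
    (λ nd → ≤⇒<punchInℕ (proj₂ (DescentOrdered-first inj od j j<n) (NoDescentIn-cons⁻ nd)))

  fromDescents-descentOrdered : ∀ n d → DescentOrdered (entry (fromDescents n d)) n d
  fromDescents-descentOrdered (suc zero)    d zero    zero    () _
  fromDescents-descentOrdered (suc zero)    d _       (suc j) _  (s≤s ())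
  fromDescents-descentOrdered (suc (suc n)) d =
    consDescent-descentOrdered d τ (entry-injective τ (proj₁ (fromDescents-isPerm (suc n) (d ∘ suc))))
                               (fromDescents-descentOrdered (suc n) (d ∘ suc))
    where τ = fromDescents (suc n) (d ∘ suc)

  record Occurrence {n m} (π : Word n) (σ : Word m) : Set where
    field
      pos      : ℕ → ℕ
      pos<     : ∀ a → a < m → pos a < n
      pos-mono : ∀ a b → a < b → b < m → pos a < pos b
      order    : ∀ a b → a < m → b < m → entry σ a < entry σ b → entry π (pos a) < entry π (pos b)

  extendFin : ∀ {m} → (Fin m → ℕ) → ℕ → ℕ
  extendFin {m} f a with a <? m
  ... | yes a<m = f (fromℕ< a<m)
  ... | no  _   = 0

  extendFin-fromℕ< : ∀ {m} (f : Fin m → ℕ) {a} (a<m : a < m) → extendFin f a ≡ f (fromℕ< a<m)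
  extendFin-fromℕ< {m} f {a} a<m with a <? m
  ... | yes _   = refl
  ... | no  a≮m = ⊥-elim (a≮m a<m)

  Contains⇒Occurrence : ∀ {n m} (π : Word n) (σ : Word m) → Contains π σ → Occurrence π σ
  Contains⇒Occurrence {n} {m} π σ (ι , ι-mono , ι-order) = record
    { pos = pos ; pos< = pos< ; pos-mono = pos-mono ; order = order }
    where
    pos : ℕ → ℕ
    pos = extendFin (toℕ ∘ ι)
    pos≡ : ∀ {a} (a<m : a < m) → pos a ≡ toℕ (ι (fromℕ< a<m))
    pos≡ = extendFin-fromℕ< (toℕ ∘ ι)
    pos< : ∀ a → a < m → pos a < n
    pos< a a<m rewrite pos≡ a<m = Fin.toℕ<n _
    pos-mono : ∀ a b → a < b → b < m → pos a < pos b
    pos-mono a b a<b b<m rewrite pos≡ (<-trans a<b b<m) | pos≡ b<m =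
      ι-mono (subst₂ _<_ (sym (Fin.toℕ-fromℕ< (<-trans a<b b<m))) (sym (Fin.toℕ-fromℕ< b<m)) a<b)
    order : ∀ a b → a < m → b < m → entry σ a < entry σ b → entry π (pos a) < entry π (pos b)
    order a b a<m b<m lt rewrite pos≡ a<m | pos≡ b<m =
      subst₂ _<_ (sym (entry-toℕ π (ι (fromℕ< a<m)))) (sym (entry-toℕ π (ι (fromℕ< b<m))))
        (Equivalence.from (ι-order (fromℕ< a<m) (fromℕ< b<m))
          (subst₂ _<_ (entry-fromℕ< σ a<m) (entry-fromℕ< σ b<m) lt))

  -- Since σ is injective, preserving its strict order already reflects it.
  Occurrence⇒Contains : ∀ {n m} (π : Word n) (σ : Word m) → InjectiveBelow (entry σ) m → Occurrence π σ → Contains π σ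
  Occurrence⇒Contains {n} {m} π σ σ-inj occ = ι , ι-mono , λ a b → mk⇔ (reflect a b) (preserve a b)
    where
    open Occurrence occ
    ι : Fin m → Fin n
    ι a = fromℕ< (pos< (toℕ a) (Fin.toℕ<n a))
    toℕ-ι : ∀ a → toℕ (ι a) ≡ pos (toℕ a)
    toℕ-ι a = Fin.toℕ-fromℕ< _
    ι-mono : StrictlyIncreasing ι
    ι-mono {a} {b} a<b rewrite toℕ-ι a | toℕ-ι b = pos-mono (toℕ a) (toℕ b) a<b (Fin.toℕ<n b)
    πι : ∀ a → toℕ (lookup π (ι a)) ≡ entry π (pos (toℕ a))
    πι a = trans (sym (entry-toℕ π (ι a))) (cong (entry π) (toℕ-ι a))
    σ≡ : ∀ a → toℕ (lookup σ a) ≡ entry σ (toℕ a)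
    σ≡ a = sym (entry-toℕ σ a)
    order′ : ∀ a b → entry σ (toℕ a) < entry σ (toℕ b) → entry π (pos (toℕ a)) < entry π (pos (toℕ b))
    order′ a b = order (toℕ a) (toℕ b) (Fin.toℕ<n a) (Fin.toℕ<n b)
    preserve : ∀ a b → lookup σ a Fin.< lookup σ b → lookup π (ι a) Fin.< lookup π (ι b)
    preserve a b lt = subst₂ _<_ (sym (πι a)) (sym (πι b)) (order′ a b (subst₂ _<_ (σ≡ a) (σ≡ b) lt))
    reflect : ∀ a b → lookup π (ι a) Fin.< lookup π (ι b) → lookup σ a Fin.< lookup σ b
    reflect a b lt with <-cmp (entry σ (toℕ a)) (entry σ (toℕ b))
    ... | tri< σa<σb _ _ = subst₂ _<_ (sym (σ≡ a)) (sym (σ≡ b)) σa<σb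
    ... | tri≈ _ σa≡σb _ with refl ← Fin.toℕ-injective (σ-inj (toℕ a) (toℕ b) (Fin.toℕ<n a) (Fin.toℕ<n b) σa≡σb)
      = ⊥-elim (<-irrefl refl lt)
    reflect a b lt | tri> _ _ σb<σa = ⊥-elim (<-asym (subst₂ _<_ (πι a) (πι b) lt) (order′ b a σb<σa))

  leftInverse⇒InjectiveBelow : ∀ f g n → (∀ a → a < n → g (f a) ≡ a) → InjectiveBelow f n
  leftInverse⇒InjectiveBelow f g n inv a b a<n b<n eq = trans (sym (inv a a<n)) (trans (cong g eq) (inv b b<n))

  -- both patterns are involutions
  p132-injective : InjectiveBelow (entry p132) 3
  p132-injective = leftInverse⇒InjectiveBelow (entry p132) (entry p132) 3 λ
    { 0 _ → refl ; 1 _ → refl ; 2 _ → refl ; (suc (suc (suc _))) (s≤s (s≤s (s≤s ()))) }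

  p213-injective : InjectiveBelow (entry p213) 3
  p213-injective = leftInverse⇒InjectiveBelow (entry p213) (entry p213) 3 λ
    { 0 _ → refl ; 1 _ → refl ; 2 _ → refl ; (suc (suc (suc _))) (s≤s (s≤s (s≤s ()))) }

  positions₃ : ℕ → ℕ → ℕ → ℕ → ℕ
  positions₃ i j l 0 = i
  positions₃ i j l 1 = j
  positions₃ i j l _ = l

  occurrence₃ : ∀ {n} (π : Word n) (σ : Word 3) {i j l} → i < j → j < l → l < n →
    (∀ a b → a < 3 → b < 3 → entry σ a < entry σ b →
       entry π (positions₃ i j l a) < entry π (positions₃ i j l b)) →
    Occurrence π σ
  occurrence₃ π σ {i} {j} {l} i<j j<l l<n order = record
    { pos = positions₃ i j l ; pos< = pos< ; pos-mono = pos-mono ; order = order }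
    where
    pos< : ∀ a → a < 3 → positions₃ i j l a < _
    pos< 0 _ = <-trans i<j (<-trans j<l l<n)
    pos< 1 _ = <-trans j<l l<n
    pos< 2 _ = l<n
    pos< (suc (suc (suc _))) (s≤s (s≤s (s≤s ())))
    pos-mono : ∀ a b → a < b → b < 3 → positions₃ i j l a < positions₃ i j l b
    pos-mono 0 1 _ _ = i<j
    pos-mono 0 2 _ _ = <-trans i<j j<l
    pos-mono 1 2 _ _ = j<l
    pos-mono 1 1 (s≤s ()) _
    pos-mono 2 1 (s≤s ()) _
    pos-mono 2 2 (s≤s (s≤s ())) _
    pos-mono _ (suc (suc (suc _))) _ (s≤s (s≤s (s≤s ())))
    pos-mono (suc (suc (suc _))) 1 (s≤s ()) _
    pos-mono (suc (suc (suc _))) 2 (s≤s (s≤s ())) _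

  Avoids132 : (ℕ → ℕ) → ℕ → Set
  Avoids132 f n = ∀ i j l → i < j → j < l → l < n → f i < f l → f l < f j → ⊥

  Avoids213 : (ℕ → ℕ) → ℕ → Set
  Avoids213 f n = ∀ i j l → i < j → j < l → l < n → f j < f i → f i < f l → ⊥

  Avoids-p132⇒Avoids132 : ∀ {n} (π : Word n) → Avoids π p132 → Avoids132 (entry π) n
  Avoids-p132⇒Avoids132 π avoid i j l i<j j<l l<n πi<πl πl<πj =
    avoid (Occurrence⇒Contains π p132 p132-injective (occurrence₃ π p132 i<j j<l l<n order))
    where
    order : ∀ a b → a < 3 → b < 3 → entry p132 a < entry p132 b →
            entry π (positions₃ i j l a) < entry π (positions₃ i j l b)
    order 0 1 _ _ _ = <-trans πi<πl πl<πj
    order 0 2 _ _ _ = πi<πl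
    order 2 1 _ _ _ = πl<πj
    order 1 1 _ _ (s≤s (s≤s ()))
    order 1 2 _ _ (s≤s ())
    order 2 2 _ _ (s≤s ())
    order (suc (suc (suc _))) _ (s≤s (s≤s (s≤s ()))) _ _
    order _ (suc (suc (suc _))) _ (s≤s (s≤s (s≤s ()))) _

  Avoids-p213⇒Avoids213 : ∀ {n} (π : Word n) → Avoids π p213 → Avoids213 (entry π) n
  Avoids-p213⇒Avoids213 π avoid i j l i<j j<l l<n πj<πi πi<πl =
    avoid (Occurrence⇒Contains π p213 p213-injective (occurrence₃ π p213 i<j j<l l<n order))
    where
    order : ∀ a b → a < 3 → b < 3 → entry p213 a < entry p213 b →
            entry π (positions₃ i j l a) < entry π (positions₃ i j l b)
    order 1 0 _ _ _ = πj<πi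
    order 0 2 _ _ _ = πi<πl
    order 1 2 _ _ _ = <-trans πj<πi πi<πl
    order 0 0 _ _ (s≤s ())
    order 2 0 _ _ (s≤s ())
    order 2 2 _ _ (s≤s (s≤s ()))
    order (suc (suc (suc _))) _ (s≤s (s≤s (s≤s ()))) _ _
    order _ (suc (suc (suc _))) _ (s≤s (s≤s (s≤s ()))) _

  DescentOrdered⇒Avoids-p132 : ∀ {n} (π : Word n) {d} → DescentOrdered (entry π) n d → Avoids π p132
  DescentOrdered⇒Avoids-p132 π {d} od contains = <-asym π₂<π₁ π₁<π₂
    where
    open Occurrence (Contains⇒Occurrence π p132 contains)
    p₀<p₁ = pos-mono 0 1 (s≤s z≤n) (s≤s (s≤s z≤n))
    p₁<p₂ = pos-mono 1 2 (s≤s (s≤s z≤n)) ≤-refl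
    p₂<n  = pos< 2 ≤-refl
    π₂<π₁ : entry π (pos 2) < entry π (pos 1)
    π₂<π₁ = order 2 1 ≤-refl (s≤s (s≤s z≤n)) (s≤s (s≤s z≤n))
    ascending : NoDescentIn d (pos 0) (pos 2)
    ascending = proj₁ (od (pos 0) (pos 2) (<-trans p₀<p₁ p₁<p₂) p₂<n) (order 0 2 (s≤s z≤n) ≤-refl (s≤s z≤n))
    π₁<π₂ : entry π (pos 1) < entry π (pos 2)
    π₁<π₂ = proj₂ (od (pos 1) (pos 2) p₁<p₂ p₂<n) (NoDescentIn-mono ascending (<⇒≤ p₀<p₁) ≤-refl)

  DescentOrdered⇒Avoids-p213 : ∀ {n} (π : Word n) {d} → DescentOrdered (entry π) n d → Avoids π p213
  DescentOrdered⇒Avoids-p213 π {d} od contains = <-asym π₁<π₀ π₀<π₁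
    where
    open Occurrence (Contains⇒Occurrence π p213 contains)
    p₀<p₁ = pos-mono 0 1 (s≤s z≤n) (s≤s (s≤s z≤n))
    p₁<p₂ = pos-mono 1 2 (s≤s (s≤s z≤n)) ≤-refl
    p₂<n  = pos< 2 ≤-refl
    π₁<π₀ : entry π (pos 1) < entry π (pos 0)
    π₁<π₀ = order 1 0 (s≤s (s≤s z≤n)) (s≤s z≤n) (s≤s z≤n)
    ascending : NoDescentIn d (pos 0) (pos 2)
    ascending = proj₁ (od (pos 0) (pos 2) (<-trans p₀<p₁ p₁<p₂) p₂<n) (order 0 2 (s≤s z≤n) ≤-refl (s≤s (s≤s z≤n)))
    π₀<π₁ : entry π (pos 0) < entry π (pos 1)
    π₀<π₁ = proj₂ (od (pos 0) (pos 1) p₀<p₁ (<-trans p₁<p₂ p₂<n)) (NoDescentIn-mono ascending ≤-refl (<⇒≤ p₁<p₂))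

  entry-∷ʳ-< : ∀ {n L} (xs : Vec (Fin n) L) y a → a < L → entry (xs ∷ʳ y) a ≡ entry xs a
  entry-∷ʳ-< (x ∷ xs) y zero    _         = refl
  entry-∷ʳ-< (x ∷ xs) y (suc a) (s≤s a<L) = entry-∷ʳ-< xs y a a<L

  entry-∷ʳ-last : ∀ {n L} (xs : Vec (Fin n) L) y → entry (xs ∷ʳ y) L ≡ toℕ y
  entry-∷ʳ-last []       y = refl
  entry-∷ʳ-last (x ∷ xs) y = entry-∷ʳ-last xs y

  entry-map-fsuc : ∀ {n L} (xs : Vec (Fin n) L) a → a < L → entry (Vec.map fsuc xs) a ≡ suc (entry xs a)
  entry-map-fsuc (x ∷ xs) zero    _         = refl
  entry-map-fsuc (x ∷ xs) (suc a) (s≤s a<L) = entry-map-fsuc xs a a<L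

  entry-allFin : ∀ L a → a < L → entry (allFin L) a ≡ a
  entry-allFin L a a<L =
    trans (entry-fromℕ< (allFin L) a<L) (trans (cong toℕ (Vec.lookup-allFin (fromℕ< a<L))) (Fin.toℕ-fromℕ< a<L))

  entry-p23k1-< : ∀ m a → a ≤ m → entry (p23k1 (suc (suc m))) a ≡ suc a
  entry-p23k1-< m a a≤m =
    trans (entry-∷ʳ-< (Vec.map fsuc (allFin (suc m))) fzero a (s≤s a≤m))
          (trans (entry-map-fsuc (allFin (suc m)) a (s≤s a≤m)) (cong suc (entry-allFin (suc m) a (s≤s a≤m))))

  entry-p23k1-last : ∀ m → entry (p23k1 (suc (suc m))) (suc m) ≡ 0
  entry-p23k1-last m = entry-∷ʳ-last (Vec.map fsuc (allFin (suc m))) fzero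

  p23k1-injective : ∀ m → InjectiveBelow (entry (p23k1 (suc (suc m)))) (suc (suc m))
  p23k1-injective m = leftInverse⇒InjectiveBelow _ predOrLast _ inverse
    where
    predOrLast : ℕ → ℕ
    predOrLast zero    = suc m
    predOrLast (suc y) = y
    inverse : ∀ a → a < suc (suc m) → predOrLast (entry (p23k1 (suc (suc m))) a) ≡ a
    inverse a (s≤s a≤sm) with m≤n⇒m<n∨m≡n a≤sm
    ... | inj₁ (s≤s a≤m) rewrite entry-p23k1-< m a a≤m = refl
    ... | inj₂ refl      rewrite entry-p23k1-last m    = refl

  strictlyIncreasing⇒+-≤ : ∀ (g : ℕ → ℕ) K → (∀ a b → a < b → b < K → g a < g b) →
                           ∀ x → x < K → g 0 + x ≤ g x
  strictlyIncreasing⇒+-≤ g K mono zero    _     = ≤-reflexive (+-identityʳ (g 0))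
  strictlyIncreasing⇒+-≤ g K mono (suc x) sx<K = begin
    g 0 + suc x   ≡⟨ +-suc (g 0) x ⟩
    suc (g 0 + x) ≤⟨ s≤s (strictlyIncreasing⇒+-≤ g K mono x (<-trans (n<1+n x) sx<K)) ⟩
    suc (g x)     ≤⟨ mono x (suc x) (n<1+n x) sx<K ⟩
    g (suc x)     ∎
    where open ≤-Reasoning

  p23k1-firstRun : ∀ {n} m (π : Word n) {d} → DescentOrdered (entry π) n d →
                   (occ : Occurrence π (p23k1 (suc (suc m)))) →
                   let open Occurrence occ in NoDescentIn d (pos 0) (pos 0 + m)
  p23k1-firstRun zero π od occ l p₀≤l l<p₀ = ⊥-elim (≤⇒≯ p₀≤l (subst (l <_) (+-identityʳ _) l<p₀))
  p23k1-firstRun (suc m) π od occ =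
    NoDescentIn-mono (proj₁ (od (pos 0) (pos (suc m)) (pos-mono 0 (suc m) (s≤s z≤n) sm<) (pos< (suc m) sm<))
                            (order 0 (suc m) (s≤s z≤n) sm<
                               (subst₂ _<_ (sym (entry-p23k1-< (suc m) 0 z≤n)) (sym (entry-p23k1-< (suc m) (suc m) ≤-refl))
                                       (s≤s (s≤s z≤n)))))
                     ≤-refl (strictlyIncreasing⇒+-≤ pos _ pos-mono (suc m) sm<)
    where
    open Occurrence occ
    sm< = s≤s (n≤1+n (suc m))

  DescentOrdered⇒Avoids-p23k1 : ∀ {n} m (π : Word n) {d} → DescentOrdered (entry π) n d → Admissible m d →
                                Avoids π (p23k1 (suc (suc m)))
  DescentOrdered⇒Avoids-p23k1 m π {d} od adm contains = <-asym last<first first<last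
    where
    occ = Contains⇒Occurrence π (p23k1 (suc (suc m))) contains
    open Occurrence occ
    firstRun = p23k1-firstRun m π od occ
    last<first : entry π (pos (suc m)) < entry π (pos 0)
    last<first = order (suc m) 0 ≤-refl (s≤s z≤n)
      (subst₂ _<_ (sym (entry-p23k1-last m)) (sym (entry-p23k1-< m 0 z≤n)) (s≤s z≤n))
    toLast : NoDescentIn d (pos 0) (pos (suc m))
    toLast l p₀≤l l<last with l <? pos 0 + m
    ... | yes l<run = firstRun l p₀≤l l<run
    ... | no  l≮run = adm (pos 0) l (firstRun) (≮⇒≥ l≮run)
    first<last : entry π (pos 0) < entry π (pos (suc m))
    first<last = proj₂ (od (pos 0) (pos (suc m)) (pos-mono 0 (suc m) (s≤s z≤n) ≤-refl) (pos< (suc m) ≤-refl)) toLast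

  module _ {f : ℕ → ℕ} {n : ℕ} (inj : InjectiveBelow f n) (no132 : Avoids132 f n) (no213 : Avoids213 f n)
           {d : ℕ → Bool} (d-spec : ∀ l → suc l < n → d l ≡ (f (suc l) <ᵇ f l)) where

    between : ∀ i l j → i < l → l < j → j < n → f i < f j → f i < f l × f l < f j
    between i l j i<l l<j j<n fi<fj = above , below
      where
      l<n = <-trans l<j j<n
      above : f i < f l
      above with <-cmp (f i) (f l)
      ... | tri< fi<fl _ _ = fi<fl
      ... | tri≈ _ fi≡fl _ = ⊥-elim (<-irrefl (inj i l (<-trans i<l l<n) l<n fi≡fl) i<l)
      ... | tri> _ _ fl<fi = ⊥-elim (no213 i l j i<l l<j j<n fl<fi fi<fj)
      below : f l < f j
      below with <-cmp (f l) (f j)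
      ... | tri< fl<fj _ _ = fl<fj
      ... | tri≈ _ fl≡fj _ = ⊥-elim (<-irrefl (inj l j l<n j<n fl≡fj) l<j)
      ... | tri> _ _ fj<fl = ⊥-elim (no132 i l j i<l l<j j<n fi<fj fj<fl)

    noDescent⇒< : ∀ l → suc l < n → d l ≡ false → f l < f (suc l)
    noDescent⇒< l sl<n dl≡false =
      ≤∧≢⇒< (≮⇒≥ f[l+1]≮fl) (λ eq → 1+n≢n (sym (inj l (suc l) (<-trans (n<1+n l) sl<n) sl<n eq)))
      where
      f[l+1]≮fl : ¬ (f (suc l) < f l)
      f[l+1]≮fl lt = subst T (trans (sym (d-spec l sl<n)) dl≡false) (<⇒<ᵇ lt)

    ≮⇒noDescent : ∀ l → suc l < n → ¬ (f (suc l) < f l) → d l ≡ false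
    ≮⇒noDescent l sl<n f[l+1]≮fl rewrite d-spec l sl<n with f (suc l) <ᵇ f l in lt
    ... | false = refl
    ... | true  = ⊥-elim (f[l+1]≮fl (<ᵇ⇒< (f (suc l)) (f l) (Equivalence.from T-≡ lt)))

    Avoids132-213⇒DescentOrdered : DescentOrdered f n d
    Avoids132-213⇒DescentOrdered i j i<j j<n = ascending i j i<j j<n , increasing i j i<j j<n
      where
      increasing : ∀ i j → i < j → j < n → NoDescentIn d i j → f i < f j
      increasing i (suc j) (s≤s i≤j) sj<n nd with m≤n⇒m<n∨m≡n i≤j
      ... | inj₂ refl = noDescent⇒< i sj<n (nd i ≤-refl (n<1+n i))
      ... | inj₁ i<j  = <-trans (increasing i j i<j (<-trans (n<1+n j) sj<n) (NoDescentIn-mono nd ≤-refl (n≤1+n j)))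
                                (noDescent⇒< j sj<n (nd j (<⇒≤ i<j) (n<1+n j)))
      ascending : ∀ i j → i < j → j < n → f i < f j → NoDescentIn d i j
      ascending i j i<j j<n fi<fj l i≤l l<j = ≮⇒noDescent l (≤-<-trans l<j j<n) descent
        where
        descent : f (suc l) < f l → ⊥
        descent fsl<fl with m≤n⇒m<n∨m≡n i≤l | m≤n⇒m<n∨m≡n l<j
        ... | inj₂ refl | inj₂ refl = <-asym fsl<fl fi<fj
        ... | inj₂ refl | inj₁ sl<j = <-asym fsl<fl (proj₁ (between i (suc i) j (n<1+n i) sl<j j<n fi<fj))
        ... | inj₁ i<l  | inj₂ refl = <-asym fsl<fl (proj₂ (between i l (suc l) i<l (n<1+n l) j<n fi<fj))
        ... | inj₁ i<l  | inj₁ sl<j = no132 i l (suc l) i<l (n<1+n l) (<-trans sl<j j<n)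
                                        (proj₁ (between i (suc l) j (<-trans i<l (n<1+n l)) sl<j j<n fi<fj)) fsl<fl

  run-then-below⇒Contains-p23k1 : ∀ {n} m (π : Word n) a e → a + m < e → e < n →
    (∀ {x y} → x < y → y ≤ m → entry π (a + x) < entry π (a + y)) → entry π e < entry π a →
    Contains π (p23k1 (suc (suc m)))
  run-then-below⇒Contains-p23k1 {n} m π a e a+m<e e<n runIncreasing e<first =
    Occurrence⇒Contains π σ (p23k1-injective m) (record { pos = pos ; pos< = pos< ; pos-mono = pos-mono ; order = order })
    where
    σ = p23k1 (suc (suc m))
    f = entry π
    a+x<e : ∀ {x} → x ≤ m → a + x < e
    a+x<e x≤m = ≤-<-trans (+-monoʳ-≤ a x≤m) a+m<e
    pos : ℕ → ℕ
    pos x with x ≤? m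
    ... | yes _ = a + x
    ... | no  _ = e
    slot : ∀ x → x < suc (suc m) → (x ≤ m × pos x ≡ a + x) ⊎ (x ≡ suc m × pos x ≡ e)
    slot x (s≤s x≤sm) with x ≤? m
    ... | yes x≤m = inj₁ (x≤m , refl)
    ... | no  x≰m with m≤n⇒m<n∨m≡n x≤sm
    ...   | inj₁ (s≤s x≤m) = ⊥-elim (x≰m x≤m)
    ...   | inj₂ x≡sm      = inj₂ (x≡sm , refl)
    first≤run : ∀ y → y ≤ m → f a ≤ f (a + y)
    first≤run zero    _    = ≤-reflexive (cong f (sym (+-identityʳ a)))
    first≤run (suc y) sy≤m = <⇒≤ (subst (λ p → f p < f (a + suc y)) (+-identityʳ a) (runIncreasing (s≤s z≤n) sy≤m))
    pos< : ∀ x → x < suc (suc m) → pos x < n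
    pos< x x< with slot x x<
    ... | inj₁ (x≤m , px) rewrite px = <-trans (a+x<e x≤m) e<n
    ... | inj₂ (_ , px)   rewrite px = e<n
    pos-mono : ∀ x y → x < y → y < suc (suc m) → pos x < pos y
    pos-mono x y x<y y< with slot x (<-trans x<y y<) | slot y y<
    ... | inj₁ (_ , px)   | inj₁ (_ , py)  rewrite px | py = +-monoʳ-< a x<y
    ... | inj₁ (x≤m , px) | inj₂ (_ , py)  rewrite px | py = a+x<e x≤m
    ... | inj₂ (refl , _) | inj₁ (y≤m , _) = ⊥-elim (<-asym x<y (s≤s y≤m))
    ... | inj₂ (refl , _) | inj₂ (refl , _) = ⊥-elim (<-irrefl refl x<y)
    order : ∀ x y → x < suc (suc m) → y < suc (suc m) → entry σ x < entry σ y → f (pos x) < f (pos y)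
    order x y x< y< lt with slot x x< | slot y y<
    ... | _ | inj₂ (refl , _) rewrite entry-p23k1-last m = ⊥-elim (n≮0 lt)
    ... | inj₁ (x≤m , px) | inj₁ (y≤m , py) rewrite px | py | entry-p23k1-< m x x≤m | entry-p23k1-< m y y≤m =
      runIncreasing (≤-pred lt) y≤m
    ... | inj₂ (refl , px) | inj₁ (y≤m , py) rewrite px | py = <-≤-trans e<first (first≤run y y≤m)

  Avoids-p23k1⇒Admissible : ∀ {n} m (π : Word n) {d} → InjectiveBelow (entry π) n → DescentOrdered (entry π) n d →
                            (∀ l → n ≤ suc l → d l ≡ false) → Avoids π (p23k1 (suc (suc m))) → Admissible m d
  Avoids-p23k1⇒Admissible {n} m π {d} inj od beyond avoid a l run a+m≤l with d l in dl
  ... | false = refl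
  ... | true with suc l <? n
  ...   | no sl≮n with () ← trans (sym dl) (beyond l (≮⇒≥ sl≮n))
  ...   | yes sl<n = ⊥-elim (avoid (run-then-below⇒Contains-p23k1 m π a (suc l) (s≤s a+m≤l) sl<n runIncreasing end<first))
    where
    f = entry π
    runIncreasing : ∀ {x y} → x < y → y ≤ m → f (a + x) < f (a + y)
    runIncreasing x<y y≤m =
      proj₂ (od _ _ (+-monoʳ-< a x<y) (≤-<-trans (≤-trans (+-monoʳ-≤ a y≤m) a+m≤l) (<-trans (n<1+n l) sl<n)))
            (NoDescentIn-mono run (m≤m+n a _) (+-monoʳ-≤ a y≤m))
    a<sl : a < suc l
    a<sl = s≤s (≤-trans (m≤m+n a m) a+m≤l)
    end<first : f (suc l) < f a
    end<first with <-cmp (f a) (f (suc l))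
    ... | tri< fa<fsl _ _
      with () ← trans (sym dl) (proj₁ (od a (suc l) a<sl sl<n) fa<fsl l (≤-trans (m≤m+n a m) a+m≤l) (n<1+n l))
    ... | tri≈ _ fa≡fsl _ = ⊥-elim (<-irrefl (inj a (suc l) (<-trans a<sl sl<n) sl<n fa≡fsl) a<sl)
    ... | tri> _ _ fsl<fa = fsl<fa

  increasing-bounded⇒id : ∀ (h : ℕ → ℕ) n → (∀ y → suc y < n → h y < h (suc y)) → (∀ y → y < n → h y < n) →
                          ∀ y → y < n → h y ≡ y
  increasing-bounded⇒id h n mono bound y y<n = ≤-antisym (upper (n ∸ suc y) y (m+[n∸m]≡n y<n)) (lower y y<n)
    where
    lower : ∀ y → y < n → y ≤ h y
    lower zero    _    = z≤n
    lower (suc y) sy<n = <-≤-trans (s≤s (lower y (<-trans (n<1+n y) sy<n))) (mono y sy<n)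
    upper : ∀ t y → suc y + t ≡ n → h y ≤ y
    upper zero    y eq = ≤-pred (<-≤-trans (bound y (≤-reflexive (trans (cong suc (sym (+-identityʳ y))) eq)))
                                           (≤-reflexive (trans (sym eq) (cong suc (+-identityʳ y)))))
    upper (suc t) y eq = ≤-pred (<-≤-trans (mono y sy<n) (upper t (suc y) eq′))
      where
      eq′ : suc (suc y) + t ≡ n
      eq′ = trans (cong suc (sym (+-suc y t))) eq
      sy<n : suc y < n
      sy<n = ≤-trans (s≤s (s≤s (m≤m+n y t))) (≤-reflexive eq′)

  DescentOrdered-transfer : ∀ {f g n d} → InjectiveBelow g n → DescentOrdered f n d → DescentOrdered g n d →
                            ∀ i j → i < n → j < n → f i < f j → g i < g j
  DescentOrdered-transfer {g = g} g-inj odf odg i j i<n j<n fi<fj with <-cmp i j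
  ... | tri< i<j _ _ = proj₂ (odg i j i<j j<n) (proj₁ (odf i j i<j j<n) fi<fj)
  ... | tri≈ _ refl _ = ⊥-elim (<-irrefl refl fi<fj)
  ... | tri> _ _ j<i with <-cmp (g i) (g j)
  ...   | tri< gi<gj _ _ = gi<gj
  ...   | tri≈ _ gi≡gj _ = ⊥-elim (<-irrefl (sym (g-inj i j i<n j<n gi≡gj)) j<i)
  ...   | tri> _ _ gj<gi = ⊥-elim (<-asym fi<fj (proj₂ (odf j i j<i i<n) (proj₁ (odg j i j<i i<n) gj<gi)))

  -- g ∘ f⁻¹ is increasing and bounded, hence the identity
  DescentOrdered-unique : ∀ {f g n d} → InjectiveBelow f n → InjectiveBelow g n →
    (∀ x → x < n → f x < n) → (∀ x → x < n → g x < n) → (∀ y → y < n → ∃ λ x → x < n × f x ≡ y) →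
    DescentOrdered f n d → DescentOrdered g n d → ∀ x → x < n → f x ≡ g x
  DescentOrdered-unique {f} {g} {n} f-inj g-inj f-bound g-bound f-surj odf odg x x<n =
    begin
      f x                 ≡⟨ sym (increasing-bounded⇒id h n h-mono h-bound (f x) fx<n) ⟩
      h (f x)             ≡⟨ h≡ (f x) fx<n ⟩
      g (f⁻¹ (f x) fx<n)  ≡⟨ cong g (f-inj _ x (f⁻¹< (f x) fx<n) x<n (f∘f⁻¹ (f x) fx<n)) ⟩
      g x                 ∎
    where
    open ≡-Reasoning
    fx<n = f-bound x x<n
    f⁻¹ : ∀ y → y < n → ℕ
    f⁻¹ y y<n = proj₁ (f-surj y y<n)
    f⁻¹< : ∀ y y<n → f⁻¹ y y<n < n
    f⁻¹< y y<n = proj₁ (proj₂ (f-surj y y<n))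
    f∘f⁻¹ : ∀ y y<n → f (f⁻¹ y y<n) ≡ y
    f∘f⁻¹ y y<n = proj₂ (proj₂ (f-surj y y<n))
    h : ℕ → ℕ
    h y with y <? n
    ... | yes y<n = g (f⁻¹ y y<n)
    ... | no  _   = 0
    h≡ : ∀ y (y<n : y < n) → h y ≡ g (f⁻¹ y y<n)
    h≡ y y<n with y <? n
    ... | yes y<n′ = cong (g ∘ f⁻¹ y) (<-irrelevant y<n′ y<n)
    ... | no  y≮n  = ⊥-elim (y≮n y<n)
    h-mono : ∀ y → suc y < n → h y < h (suc y)
    h-mono y sy<n rewrite h≡ y (<-trans (n<1+n y) sy<n) | h≡ (suc y) sy<n =
      DescentOrdered-transfer g-inj odf odg _ _ (f⁻¹< y _) (f⁻¹< (suc y) sy<n)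
        (subst₂ _<_ (sym (f∘f⁻¹ y _)) (sym (f∘f⁻¹ (suc y) sy<n)) (n<1+n y))
    h-bound : ∀ y → y < n → h y < n
    h-bound y y<n rewrite h≡ y y<n = g-bound _ (f⁻¹< y y<n)

  descents : ∀ {n L} → Vec (Fin n) L → List Bool
  descents []           = []
  descents (x ∷ [])     = []
  descents (x ∷ y ∷ xs) = (toℕ y <ᵇ toℕ x) ∷ descents (y ∷ xs)

  bitAt-descents : ∀ {n L} (xs : Vec (Fin n) L) l → suc l < L → bitAt (descents xs) l ≡ (entry xs (suc l) <ᵇ entry xs l)
  bitAt-descents (x ∷ y ∷ xs) zero    _          = refl
  bitAt-descents (x ∷ y ∷ xs) (suc l) (s≤s sl<L) = bitAt-descents (y ∷ xs) l sl<L
  bitAt-descents (x ∷ [])     l       (s≤s ())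

  length-descents : ∀ {n L} (xs : Vec (Fin n) L) → length (descents xs) ≡ L ∸ 1
  length-descents []           = refl
  length-descents (x ∷ [])     = refl
  length-descents (x ∷ y ∷ xs) = cong suc (length-descents (y ∷ xs))

  bitAt-descents-beyond : ∀ {n L} (xs : Vec (Fin n) L) l → L ≤ suc l → bitAt (descents xs) l ≡ false
  bitAt-descents-beyond xs l L≤sl =
    bitAt-beyond (descents xs) l (≤-trans (≤-reflexive (length-descents xs)) (∸-monoˡ-≤ 1 L≤sl))

  DescentOrdered⇒<ᵇ : ∀ {f n d} → InjectiveBelow f n → DescentOrdered f n d →
                      ∀ l → suc l < n → (f (suc l) <ᵇ f l) ≡ d l
  DescentOrdered⇒<ᵇ {f} {d = d} inj od l sl<n with d l in dl
  ... | false with f (suc l) <ᵇ f l in lt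
  ...   | false = refl
  ...   | true  = ⊥-elim (<-asym (<ᵇ⇒< _ _ (Equivalence.from T-≡ lt)) (proj₂ (od l (suc l) (n<1+n l) sl<n) single))
    where
    single : NoDescentIn d l (suc l)
    single l′ l≤l′ l′<sl with ≤-antisym l≤l′ (≤-pred l′<sl)
    ... | refl = dl
  DescentOrdered⇒<ᵇ {f} {d = d} inj od l sl<n | true with <-cmp (f l) (f (suc l))
  ... | tri< fl<fsl _ _ with () ← trans (sym dl) (proj₁ (od l (suc l) (n<1+n l) sl<n) fl<fsl l ≤-refl (n<1+n l))
  ... | tri≈ _ fl≡fsl _ = ⊥-elim (1+n≢n (sym (inj l (suc l) (<-trans (n<1+n l) sl<n) sl<n fl≡fsl)))
  ... | tri> _ _ fsl<fl = Equivalence.to T-≡ (<⇒<ᵇ fsl<fl)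

  descents-fromDescents : ∀ n w → length w ≡ n ∸ 1 → descents (fromDescents n (bitAt w)) ≡ w
  descents-fromDescents n w len = bitAt-injective (descents π) w (trans (length-descents π) (sym len)) sameBit
    where
    π = fromDescents n (bitAt w)
    sameBit : ∀ l → bitAt (descents π) l ≡ bitAt w l
    sameBit l with suc l <? n
    ... | yes sl<n = trans (bitAt-descents π l sl<n)
                           (DescentOrdered⇒<ᵇ (entry-injective π (proj₁ (fromDescents-isPerm n (bitAt w))))
                                              (fromDescents-descentOrdered n (bitAt w)) l sl<n)
    ... | no  sl≮n = trans (bitAt-descents-beyond π l (≮⇒≥ sl≮n))
                           (sym (bitAt-beyond w l (≤-trans (≤-reflexive len) (∸-monoˡ-≤ 1 (≮⇒≥ sl≮n)))))

  fromDescents-inAv : ∀ m n d → Admissible m d → InAv (suc (suc m)) n (fromDescents n d)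
  fromDescents-inAv m n d adm =
    fromDescents-isPerm n d ,
    DescentOrdered⇒Avoids-p132 π od , DescentOrdered⇒Avoids-p213 π od , DescentOrdered⇒Avoids-p23k1 m π od adm
    where
    π  = fromDescents n d
    od = fromDescents-descentOrdered n d

  inAv⇒fromDescents : ∀ m n (π : Word n) → InAv (suc (suc m)) n π →
                      Admissible m (bitAt (descents π)) × π ≡ fromDescents n (bitAt (descents π))
  inAv⇒fromDescents m n π ((π-inj , π-surj) , avoid132 , avoid213 , avoid23k1) =
    Avoids-p23k1⇒Admissible m π inj od (bitAt-descents-beyond π) avoid23k1 ,
    entry-ext π σ (DescentOrdered-unique inj σ-inj (entry< π) (entry< σ) (entry-surjective π π-surj) od σ-od)
    where
    d     = bitAt (descents π)
    σ     = fromDescents n d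
    inj   = entry-injective π π-inj
    σ-inj = entry-injective σ (proj₁ (fromDescents-isPerm n d))
    σ-od  = fromDescents-descentOrdered n d
    od    = Avoids132-213⇒DescentOrdered inj (Avoids-p132⇒Avoids132 π avoid132) (Avoids-p213⇒Avoids213 π avoid213)
                                         (bitAt-descents π)

  Unique-map⁺ : ∀ {A B : Set} (f : A → B) {xs : List A} → (∀ {x y} → x ∈ xs → y ∈ xs → f x ≡ f y → x ≡ y) →
                Unique xs → Unique (map f xs)
  Unique-map⁺ f {[]}     inj []         = []
  Unique-map⁺ f {x ∷ xs} inj (x∉ ∷ uniq) =
    All.map⁺ (All.tabulate (λ y∈ fx≡fy → All.lookup x∉ y∈ (inj (here refl) (there y∈) fx≡fy)))
    ∷ Unique-map⁺ f (λ x∈ y∈ → inj (there x∈) (there y∈)) uniq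

  InAv-size : ∀ m n → HasSize (InAv (suc (suc m)) (suc n)) (sumF m (suc n))
  InAv-size m n = perms , unique , (λ π → mk⇔ (sound π) (complete π)) , size
    where
    open AdmissibleWords m
    toPerm : List Bool → Word (suc n)
    toPerm w = fromDescents (suc n) (bitAt w)
    perms = map toPerm (admissibleWords n)
    sound : ∀ π → π ∈ perms → InAv (suc (suc m)) (suc n) π
    sound π π∈ with ∈-map⁻ toPerm π∈
    ... | w , w∈ , refl = fromDescents-inAv m (suc n) (bitAt w)
                            (Equivalence.to (admissibleFrom⇔Admissible w) (proj₂ (∈-admissibleWords⁻ n w w∈)))
    complete : ∀ π → InAv (suc (suc m)) (suc n) π → π ∈ perms
    complete π inAv with inAv⇒fromDescents m (suc n) π inAv
    ... | adm , π≡ = subst (_∈ perms) (sym π≡) (∈-map⁺ toPerm (subst (λ L → descents π ∈ admissibleWords L)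
          (length-descents π) (∈-admissibleWords⁺ (descents π) (Equivalence.from (admissibleFrom⇔Admissible (descents π)) adm))))
    unique : Unique perms
    unique = Unique-map⁺ toPerm (λ {w} {w′} w∈ w′∈ eq →
      trans (sym (descents-fromDescents (suc n) w (proj₁ (∈-admissibleWords⁻ n w w∈))))
            (trans (cong descents eq) (descents-fromDescents (suc n) w′ (proj₁ (∈-admissibleWords⁻ n w′ w′∈)))))
      (admissibleWords-unique n)
    size : length perms ≡ sumF m (suc n)
    size = trans (length-map toPerm (admissibleWords n)) (length-admissibleWords n)

  ∈-─ : ∀ {A : Set} {x z : A} (ys : List A) (x∈ : x ∈ ys) → z ∈ ys → z ≢ x → z ∈ (ys ─ x∈)
  ∈-─ (y ∷ ys) (here refl) (here refl) z≢x = ⊥-elim (z≢x refl)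
  ∈-─ (y ∷ ys) (here refl) (there z∈)  _   = z∈
  ∈-─ (y ∷ ys) (there x∈)  (here refl) _   = here refl
  ∈-─ (y ∷ ys) (there x∈)  (there z∈)  z≢x = there (∈-─ ys x∈ z∈ z≢x)

  Unique-⊆⇒length-≤ : ∀ {A : Set} (xs ys : List A) → Unique xs → (∀ {x} → x ∈ xs → x ∈ ys) →
                      length xs ≤ length ys
  Unique-⊆⇒length-≤ []       ys _            _  = z≤n
  Unique-⊆⇒length-≤ (x ∷ xs) ys (x∉ ∷ uniq) xs⊆ys = begin
    suc (length xs)        ≤⟨ s≤s (Unique-⊆⇒length-≤ xs (ys ─ x∈) uniq
                                    (λ z∈ → ∈-─ ys x∈ (xs⊆ys (there z∈)) (λ z≡x → All.lookup x∉ z∈ (sym z≡x)))) ⟩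
    suc (length (ys ─ x∈)) ≡⟨ sym (length-removeAt′ ys (index x∈)) ⟩
    length ys              ∎
    where
    open ≤-Reasoning
    x∈ = xs⊆ys (here refl)

  HasSize-unique : ∀ {A : Set} {P : A → Set} {a b} → HasSize P a → HasSize P b → a ≡ b
  HasSize-unique (xs , xs-unique , xs-enum , refl) (ys , ys-unique , ys-enum , refl) =
    ≤-antisym (Unique-⊆⇒length-≤ xs ys xs-unique (λ {x} → Equivalence.from (ys-enum x) ∘ Equivalence.to (xs-enum x)))
              (Unique-⊆⇒length-≤ ys xs ys-unique (λ {x} → Equivalence.from (xs-enum x) ∘ Equivalence.to (ys-enum x)))

  InAv-size-zero : ∀ k → 1 ≤ k → HasSize (InAv k 0) 1
  InAv-size-zero (suc k) _ =
    ([] ∷ []) , (All.[] ∷ []) , (λ { [] → mk⇔ (λ { (here refl) → inAv }) (λ _ → here refl) }) , refl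
    where
    nothingIn[] : ∀ {m} (σ : Word (suc m)) → Avoids {0} [] σ
    nothingIn[] σ (ι , _) with () ← ι fzero
    inAv : InAv (suc k) 0 []
    inAv = ((λ { {()} }) , (λ ())) , nothingIn[] p132 , nothingIn[] p213 , nothingIn[] (p23k1 (suc k))

module GeneratingFunction where

  open import Data.Nat using (ℕ; zero; suc; _∸_; _<_; z≤n; s≤s; _<ᵇ_; _≤ᵇ_; _≡ᵇ_)
  import Data.Nat as ℕ
  import Data.Nat.Properties as ℕ
  open import Data.Integer using (ℤ; +_; -[1+_]; _+_; _*_; _-_)
  open import Data.Integer.Properties
  open import Data.Integer.Tactic.RingSolver using (solve-∀)
  open import Data.Bool using (Bool; true; false; T; if_then_else_)
  open import Data.Bool.Properties using (T-≡)
  open import Data.List using (map; applyUpTo)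
  open import Function using (_∘_)
  open import Function.Bundles using (Equivalence)
  open import Relation.Binary.PropositionalEquality
  open Enumeration using (sumF-recurrence; sumF-zero-suc)

  sumTo : (ℕ → ℤ) → ℕ → ℤ
  sumTo t zero    = + 0
  sumTo t (suc N) = t 0 + sumTo (t ∘ suc) N

  sumℤ-map-applyUpTo : ∀ (t : ℕ → ℤ) h N → sumℤ (map t (applyUpTo h N)) ≡ sumTo (t ∘ h) N
  sumℤ-map-applyUpTo t h zero    = refl
  sumℤ-map-applyUpTo t h (suc N) = cong (λ z → t (h 0) + z) (sumℤ-map-applyUpTo t (h ∘ suc) N)

  ⊛-sumTo : ∀ f g n → (f ⊛ g) n ≡ sumTo (λ i → f i * g (n ∸ i)) (suc n)
  ⊛-sumTo f g n = sumℤ-map-applyUpTo (λ i → f i * g (n ∸ i)) (λ i → i) (suc n)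

  sumTo-cong : ∀ t t′ N → (∀ i → i < N → t i ≡ t′ i) → sumTo t N ≡ sumTo t′ N
  sumTo-cong t t′ zero    eq = refl
  sumTo-cong t t′ (suc N) eq = cong₂ _+_ (eq 0 (s≤s z≤n)) (sumTo-cong _ _ N (λ i i<N → eq (suc i) (s≤s i<N)))

  sumTo-zero : ∀ t N → (∀ i → i < N → t i ≡ + 0) → sumTo t N ≡ + 0
  sumTo-zero t N zeros = trans (sumTo-cong t (λ _ → + 0) N zeros) (allZero N)
    where
    allZero : ∀ N → sumTo (λ _ → + 0) N ≡ + 0
    allZero zero    = refl
    allZero (suc N) = trans (+-identityˡ _) (allZero N)

  sumTo-suc : ∀ t N → sumTo t (suc N) ≡ sumTo t N + t N
  sumTo-suc t zero    = trans (+-identityʳ (t 0)) (sym (+-identityˡ (t 0)))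
  sumTo-suc t (suc N) = trans (cong (λ z → t 0 + z) (sumTo-suc (t ∘ suc) N)) (sym (+-assoc (t 0) _ _))

  sumTo-reverse : ∀ t n → sumTo t (suc n) ≡ sumTo (λ j → t (n ∸ j)) (suc n)
  sumTo-reverse t zero    = refl
  sumTo-reverse t (suc n) = begin
    t 0 + sumTo (t ∘ suc) (suc n)                    ≡⟨ cong (λ z → t 0 + z) (sumTo-reverse (t ∘ suc) n) ⟩
    t 0 + sumTo (λ j → t (suc (n ∸ j))) (suc n)      ≡⟨ cong (λ z → t 0 + z) (sumTo-cong _ _ (suc n) (λ j j≤n →
                                                          cong t (sym (ℕ.+-∸-assoc 1 (ℕ.≤-pred j≤n))))) ⟩
    t 0 + sumTo (λ j → t (suc n ∸ j)) (suc n)        ≡⟨ +-comm (t 0) _ ⟩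
    sumTo (λ j → t (suc n ∸ j)) (suc n) + t 0        ≡⟨ cong (λ i → sumTo (λ j → t (suc n ∸ j)) (suc n) + t i)
                                                             (sym (ℕ.n∸n≡0 n)) ⟩
    sumTo (λ j → t (suc n ∸ j)) (suc n) + t (suc n ∸ suc n) ≡⟨ sym (sumTo-suc (λ j → t (suc n ∸ j)) (suc n)) ⟩
    sumTo (λ j → t (suc n ∸ j)) (suc (suc n))        ∎
    where open ≡-Reasoning

  indicator : Bool → ℤ
  indicator true  = + 1
  indicator false = + 0

  sumTo-indicator : ∀ (a : ℕ → ℤ) s N → sumTo (λ j → a j * indicator (j ≡ᵇ s)) N ≡ (if s <ᵇ N then a s else + 0)
  sumTo-indicator a s       zero    = refl
  sumTo-indicator a zero    (suc N) =
    trans (cong₂ _+_ (*-identityʳ (a 0)) (sumTo-zero _ N (λ i _ → *-zeroʳ (a (suc i))))) (+-identityʳ (a 0))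
  sumTo-indicator a (suc s) (suc N) =
    trans (cong (_+ sumTo (λ j → a (suc j) * indicator (j ≡ᵇ s)) N) (*-zeroʳ (a 0)))
          (trans (+-identityˡ _) (sumTo-indicator (a ∘ suc) s N))

  x⊛-suc : ∀ f n → (xₛ ⊛ f) (suc n) ≡ f n
  x⊛-suc f n = trans (⊛-sumTo xₛ f (suc n))
    (trans (cong (λ z → + 0 + (+ 1 * f n + z)) (sumTo-zero _ n (λ _ _ → refl)))
      (trans (+-identityˡ _) (trans (+-identityʳ _) (*-identityˡ _))))

  [1-x]⊛-suc : ∀ u n → ((oneₛ ⊖ xₛ) ⊛ u) (suc n) ≡ u (suc n) - u n
  [1-x]⊛-suc u n = begin
    ((oneₛ ⊖ xₛ) ⊛ u) (suc n)                                      ≡⟨ ⊛-sumTo (oneₛ ⊖ xₛ) u (suc n) ⟩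
    + 1 * u (suc n) + (-[1+ 0 ] * u n + sumTo (λ i → + 0 * u (n ∸ suc i)) n)
                                                                   ≡⟨ cong (λ z → + 1 * u (suc n) + (-[1+ 0 ] * u n + z))
                                                                           (sumTo-zero _ n (λ _ _ → refl)) ⟩
    + 1 * u (suc n) + (-[1+ 0 ] * u n + + 0)                       ≡⟨ normalise (u (suc n)) (u n) ⟩
    u (suc n) - u n                                                ∎
    where
    open ≡-Reasoning
    normalise : ∀ a b → + 1 * a + (-[1+ 0 ] * b + + 0) ≡ a - b
    normalise = solve-∀

  xsum-suc : ∀ m j → xsum m (suc j) ≡ indicator (suc j ≤ᵇ m)
  xsum-suc m j with suc j ≤ᵇ m
  ... | true  = refl
  ... | false = refl

  indicator-≤ᵇ-difference : ∀ m j → indicator (suc j ≤ᵇ m) - indicator (suc (suc j) ≤ᵇ m) ≡ indicator (suc j ≡ᵇ m)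
  indicator-≤ᵇ-difference zero                j       = refl
  indicator-≤ᵇ-difference (suc zero)          zero    = refl
  indicator-≤ᵇ-difference (suc (suc m))       zero    = refl
  indicator-≤ᵇ-difference (suc m)             (suc j) = indicator-≤ᵇ-difference m j

  module _ (m : ℕ) where

    fibSums : Series
    fibSums n = + sumF m (suc n)

    denominator : Series
    denominator = (oneₛ ⊖ xₛ) ⊛ (oneₛ ⊖ xsum m)

    denominator-zero : denominator 0 ≡ + 1
    denominator-zero = ⊛-sumTo (oneₛ ⊖ xₛ) (oneₛ ⊖ xsum m) 0

    denominator-one : denominator 1 ≡ (+ 0 - indicator (1 ≤ᵇ m)) - + 1
    denominator-one = trans ([1-x]⊛-suc (oneₛ ⊖ xsum m) 0) (cong (λ a → (+ 0 - a) - + 1) (xsum-suc m 0))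

    denominator-suc-suc : ∀ j → denominator (suc (suc j)) ≡ indicator (suc j ≡ᵇ m)
    denominator-suc-suc j = begin
      denominator (suc (suc j))                                  ≡⟨ [1-x]⊛-suc (oneₛ ⊖ xsum m) (suc j) ⟩
      (+ 0 - xsum m (suc (suc j))) - (+ 0 - xsum m (suc j))     ≡⟨ cong₂ (λ a b → (+ 0 - a) - (+ 0 - b))
                                                                          (xsum-suc m (suc j)) (xsum-suc m j) ⟩
      (+ 0 - indicator (suc (suc j) ≤ᵇ m)) - (+ 0 - indicator (suc j ≤ᵇ m))
                                                                 ≡⟨ normalise (indicator (suc j ≤ᵇ m)) (indicator (suc (suc j) ≤ᵇ m)) ⟩
      indicator (suc j ≤ᵇ m) - indicator (suc (suc j) ≤ᵇ m)     ≡⟨ indicator-≤ᵇ-difference m j ⟩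
      indicator (suc j ≡ᵇ m)                                     ∎
      where
      open ≡-Reasoning
      normalise : ∀ a b → (+ 0 - b) - (+ 0 - a) ≡ a - b
      normalise = solve-∀

    fibSums⊛denominator : ∀ n → (fibSums ⊛ denominator) n ≡ sumTo (λ j → fibSums (n ∸ j) * denominator j) (suc n)
    fibSums⊛denominator n =
      trans (⊛-sumTo fibSums denominator n)
        (trans (sumTo-reverse (λ i → fibSums i * denominator (n ∸ i)) n)
          (sumTo-cong _ _ (suc n) (λ j j≤n →
            cong (λ i → fibSums (n ∸ j) * denominator i) (ℕ.m∸[m∸n]≡n (ℕ.≤-pred j≤n)))))

    fibSums⊛denominator-suc : ∀ n → (fibSums ⊛ denominator) (suc n) ≡
      fibSums (suc n) * + 1 + (fibSums n * ((+ 0 - indicator (1 ≤ᵇ m)) - + 1)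
                               + sumTo (λ j → fibSums (n ∸ suc j) * indicator (suc j ≡ᵇ m)) n)
    fibSums⊛denominator-suc n = begin
      (fibSums ⊛ denominator) (suc n)
        ≡⟨ fibSums⊛denominator (suc n) ⟩
      fibSums (suc n) * denominator 0 + (fibSums n * denominator 1 + tail (denominator ∘ suc ∘ suc))
        ≡⟨ cong₂ (λ a b → fibSums (suc n) * a + (fibSums n * b + tail (denominator ∘ suc ∘ suc)))
                 denominator-zero denominator-one ⟩
      fibSums (suc n) * + 1 + (fibSums n * ((+ 0 - indicator (1 ≤ᵇ m)) - + 1) + tail (denominator ∘ suc ∘ suc))
        ≡⟨ cong (λ c → fibSums (suc n) * + 1 + (fibSums n * ((+ 0 - indicator (1 ≤ᵇ m)) - + 1) + c))
                (sumTo-cong _ _ n (λ j _ → cong (fibSums (n ∸ suc j) *_) (denominator-suc-suc j))) ⟩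
      fibSums (suc n) * + 1 + (fibSums n * ((+ 0 - indicator (1 ≤ᵇ m)) - + 1) + tail (λ j → indicator (suc j ≡ᵇ m)))
        ∎
      where
      open ≡-Reasoning
      tail : Series → ℤ
      tail c = sumTo (λ j → fibSums (n ∸ suc j) * c j) n

  fibSums⊛denominator≈one : ∀ m → (fibSums m ⊛ denominator m) ≈ₛ oneₛ
  fibSums⊛denominator≈one m zero = trans (fibSums⊛denominator m 0) (cong (λ z → + sumF m 1 * z + + 0) (denominator-zero m))
  fibSums⊛denominator≈one zero (suc n) = begin
    (fibSums 0 ⊛ denominator 0) (suc n)
      ≡⟨ fibSums⊛denominator-suc 0 n ⟩
    fibSums 0 (suc n) * + 1 + (fibSums 0 n * ((+ 0 - + 0) - + 1) + sumTo (λ j → fibSums 0 (n ∸ suc j) * + 0) n)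
      ≡⟨ cong (λ c → fibSums 0 (suc n) * + 1 + (fibSums 0 n * ((+ 0 - + 0) - + 1) + c))
              (sumTo-zero _ n (λ j _ → *-zeroʳ (fibSums 0 (n ∸ suc j)))) ⟩
    fibSums 0 (suc n) * + 1 + (fibSums 0 n * ((+ 0 - + 0) - + 1) + + 0)
      ≡⟨ cong₂ (λ a b → + a * + 1 + (+ b * ((+ 0 - + 0) - + 1) + + 0)) (sumF-zero-suc (suc n)) (sumF-zero-suc n) ⟩
    + 0 ∎
    where open ≡-Reasoning
  fibSums⊛denominator≈one m@(suc m′) (suc n) = begin
    (fibSums m ⊛ denominator m) (suc n)
      ≡⟨ fibSums⊛denominator-suc m n ⟩
    fibSums m (suc n) * + 1 + (fibSums m n * ((+ 0 - + 1) - + 1) + sumTo (λ j → fibSums m (n ∸ suc j) * indicator (j ≡ᵇ m′)) n)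
      ≡⟨ cong (λ c → fibSums m (suc n) * + 1 + (fibSums m n * ((+ 0 - + 1) - + 1) + c))
              (trans (sumTo-indicator (λ j → fibSums m (n ∸ suc j)) m′ n) lag) ⟩
    + A * + 1 + (+ B * ((+ 0 - + 1) - + 1) + + C)
      ≡⟨ normalise (+ A) (+ B) (+ C) ⟩
    + (A ℕ.+ C) - (+ B + + B)
      ≡⟨ cong (λ z → + z - (+ B + + B)) (sumF-recurrence m n) ⟩
    (+ B + + B) - (+ B + + B)
      ≡⟨ +-inverseʳ (+ B + + B) ⟩
    + 0 ∎
    where
    open ≡-Reasoning
    A = sumF m (suc (suc n))
    B = sumF m (suc n)
    C = sumF m (suc n ∸ m)
    -- sumF m 0 = 0 makes the truncated index suc n ∸ m harmless
    lag : (if m′ <ᵇ n then fibSums m (n ∸ suc m′) else + 0) ≡ + C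
    lag with m′ <ᵇ n in lt
    ... | true  = cong (λ i → + sumF m i) (sym (ℕ.+-∸-assoc 1 (ℕ.<ᵇ⇒< m′ n (Equivalence.from T-≡ lt))))
    ... | false =
      cong (λ i → + sumF m i) (sym (ℕ.m≤n⇒m∸n≡0 {suc n} {m} (ℕ.≮⇒≥ (λ m′<n → subst T lt (ℕ.<⇒<ᵇ m′<n)))))
    normalise : ∀ a b c → a * + 1 + (b * ((+ 0 - + 1) - + 1) + c) ≡ (a + c) - (b + b)
    normalise = solve-∀

open import Data.Nat using (ℕ; zero; suc; _≤_; _∸_; z≤n; s≤s)
open import Data.Integer using (+_)
import Data.Integer.Properties as ℤ
open import Data.Product using (_×_; _,_; ∃)
open import Relation.Binary.PropositionalEquality using (_≡_; cong; sym; trans)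
open Enumeration using (InAv-size; InAv-size-zero; HasSize-unique)
open GeneratingFunction using (fibSums; x⊛-suc; fibSums⊛denominator≈one)

proposition5p8 :
    ((k n : ℕ) → 2 ≤ k → 1 ≤ n → HasSize (InAv k n) (sumF (k ∸ 2) n))
    ×
    ((k : ℕ) → 2 ≤ k → (c : ℕ → ℕ) → ((n : ℕ) → HasSize (InAv k n) (c n)) →
      ∃ λ g → (g ⊛ ((oneₛ ⊖ xₛ) ⊛ (oneₛ ⊖ xsum (k ∸ 2)))) ≈ₛ oneₛ
        × ((λ n → + c n) ≈ₛ ((xₛ ⊛ g) ⊕ oneₛ)))
proposition5p8 = count , generatingFunction
  where
  count : (k n : ℕ) → 2 ≤ k → 1 ≤ n → HasSize (InAv k n) (sumF (k ∸ 2) n)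
  count (suc (suc m)) (suc n) (s≤s (s≤s z≤n)) (s≤s z≤n) = InAv-size m n
  generatingFunction : (k : ℕ) → 2 ≤ k → (c : ℕ → ℕ) → ((n : ℕ) → HasSize (InAv k n) (c n)) →
    ∃ λ g → (g ⊛ ((oneₛ ⊖ xₛ) ⊛ (oneₛ ⊖ xsum (k ∸ 2)))) ≈ₛ oneₛ × ((λ n → + c n) ≈ₛ ((xₛ ⊛ g) ⊕ oneₛ))
  generatingFunction (suc (suc m)) (s≤s (s≤s z≤n)) c c-size = fibSums m , fibSums⊛denominator≈one m , coefficient
    where
    coefficient : ∀ n → + c n ≡ ((xₛ ⊛ fibSums m) ⊕ oneₛ) n
    coefficient zero    = cong +_ (HasSize-unique (c-size 0) (InAv-size-zero (suc (suc m)) (s≤s z≤n)))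
    coefficient (suc n) = trans (cong +_ (HasSize-unique (c-size (suc n)) (InAv-size m n)))
                                (sym (trans (ℤ.+-identityʳ _) (x⊛-suc (fibSums m) n)))
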